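{- There is an absolute constant $C>0$ such that for all positive integers $n$ and $r$ the following holds. For every input of online Min-Sum Set Cover over a universe of $n$ elements whose requested sets have cardinality at most $r$, and for every offline algorithm $\mathrm{Off}$ that keeps one fixed permutation throughout (of its own choosing, possibly different from the initial permutation $\pi_0$), we have $$\mathrm{DLM}(\mathcal I)\le C\, r\cdot \mathrm{Off}(\mathcal I)+\xi,$$ where $\xi$ does not depend on the request sequence. In other words, DLM is $O(r)$-competitive in the static scenario.
   Context: Online Min-Sum Set Cover (MSSC). Let $\mathcal U$ be a universe of $n$ elements. A permutation is a bijection $\pi:\mathcal U\to\{1,\dots,n\}$, where $\pi(z)$ is the list position of $z$. An input $\mathcal I$ consists of an initial permutation $\pi_0$ and a sequence of nonempty sets $R_1,\dots,R_m\subseteq\mathcal U$, each of cardinality at most $r$. In step $t$, an algorithm holding permutation $\pi_{t-1}$ is shown $R_t$ and pays the access cost $\min_{z\in R_t}\pi_{t-1}(z)$. It then picks a new permutation $\pi_t$ and pays the reordering cost $d(\pi_{t-1},\pi_t)$, which is the minimum number of swaps of adjacent elements turning $\pi_{t-1}$ into $\pi_t$. An online algorithm chooses $\pi_t$ without knowing future requests or $m$. $A(\mathcal I)$ denotes the total cost of algorithm $A$ on $\mathcal I$. The static scenario compares an online algorithm, which starts from $\pi_0$, with offline algorithms that use a single fixed permutation for the whole input and pay only access costs. Algorithm DLM. Every element $z$ has a budget $b(z)$, initially $0$. The operation fetch$(z)$ moves $z$ to position 1 by $\pi(z)-1$ adjacent swaps, so every element that preceded $z$ moves back by one position, and then sets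 $b(z)\gets 0$. On a request $R$ with $|R|=s$, let $x\in R$ be the element of $R$ with the smallest current position and let $\ell=\pi(x)$. DLM pays access cost $\ell$ and executes fetch$(x)$. For every $y\in R\setminus\{x\}$ it sets $b(y)\gets b(y)+\ell/s$. Finally, while some element $z$ has $b(z)\ge \pi(z)$, it executes fetch$(z)$ for such a $z$. -}

module Defs where

open import Data.Nat using (ℕ; zero; suc; _+_; _*_; _∸_; _≤_; _<_; _<?_)
open import Data.Integer using (+_)
open import Data.Rational using (ℚ; 0ℚ; _/_) renaming (_+_ to _+ℚ_; _≤_ to _≤ℚ_; _<_ to _<ℚ_)
open import Data.Fin using (Fin; _≟_)
open import Data.Fin.Subset using (Subset; _∈_; _∉_; ∣_∣; Nonempty)
open import Data.Fin.Subset.Properties using (_∈?_)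
open import Data.List using (List; []; _∷_; filter; length; cartesianProduct; allFin)
open import Data.Product using (_×_; _,_; proj₁; proj₂; Σ; ∃; ∃-syntax)
open import Relation.Nullary using (¬_; ¬?; yes; no)
open import Relation.Nullary.Decidable using (_×-dec_)
open import Relation.Binary.PropositionalEquality using (_≡_)

-- A permutation of the universe Fin n is represented by its list order
-- (first element = position 1); it is a permutation when it is ↭ allFin n.

pos : ∀ {n} → List (Fin n) → Fin n → ℕ
pos [] z = 1
pos (x ∷ xs) z with x ≟ z
... | yes _ = 1
... | no  _ = suc (pos xs z)

-- d(π,π') : minimum number of adjacent swaps turning π into π'
-- = number of inverted pairs (Kendall tau distance)
swapDist : ∀ {n} → List (Fin n) → List (Fin n) → ℕ
swapDist {n} xs ys =
  length (filter (λ p → (pos xs (proj₁ p) <? pos xs (proj₂ p))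
                         ×-dec (pos ys (proj₂ p) <? pos ys (proj₁ p)))
                 (cartesianProduct (allFin n) (allFin n)))

-- min_{z ∈ R} σ(z) for an order σ (position of the first element of σ in R)
accessCost : ∀ {n} → List (Fin n) → Subset n → ℕ
accessCost [] R = 1
accessCost (x ∷ xs) R with x ∈? R
... | yes _ = 1
... | no  _ = suc (accessCost xs R)

offCost : ∀ {n} → List (Fin n) → List (Subset n) → ℕ
offCost σ [] = 0
offCost σ (R ∷ Rs) = accessCost σ R + offCost σ Rs

record State (n : ℕ) : Set where
  constructor ⟨_,_⟩
  field
    order  : List (Fin n)
    budget : Fin n → ℚ
open State public

fetch : ∀ {n} → Fin n → State n → State n
fetch z ⟨ xs , b ⟩ = ⟨ z ∷ filter (λ y → ¬? (y ≟ z)) xs , b' ⟩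
  where
    b' : Fin _ → ℚ
    b' y with y ≟ z
    ... | yes _ = 0ℚ
    ... | no  _ = b y

-- the amount ℓ / s (s = |R| ≥ 1 for requests)
share : ℕ → ℕ → ℚ
share ℓ zero = 0ℚ
share ℓ (suc k) = (+ ℓ) / suc k

charge : ∀ {n} → Fin n → ℕ → Subset n → State n → State n
charge x ℓ R ⟨ xs , b ⟩ = ⟨ xs , b' ⟩
  where
    b' : Fin _ → ℚ
    b' y with y ∈? R | y ≟ x
    ... | yes _ | no _ = b y +ℚ share ℓ ∣ R ∣
    ... | _     | _    = b y

ℕtoℚ : ℕ → ℚ
ℕtoℚ k = (+ k) / 1

-- "while some z has b(z) ≥ π(z), fetch(z) for such a z"
-- (any choice of such z is allowed: a relation from start to end state)
data Cleanup {n : ℕ} : State n → State n → Set where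
  stop : ∀ {s} → (∀ z → budget s z <ℚ ℕtoℚ (pos (order s) z)) → Cleanup s s
  go   : ∀ {s s'} (z : Fin n) → ℕtoℚ (pos (order s) z) ≤ℚ budget s z →
         Cleanup (fetch z s) s' → Cleanup s s'

data Step {n : ℕ} (R : Subset n) : State n → ℕ → State n → Set where
  step : ∀ {s s'} (x : Fin n) → x ∈ R →
         (∀ y → y ∈ R → pos (order s) x ≤ pos (order s) y) →
         Cleanup (charge x (pos (order s) x) R (fetch x s)) s' →
         Step R s (pos (order s) x + swapDist (order s) (order s')) s'

data Run {n : ℕ} : State n → List (Subset n) → ℕ → State n → Set where
  done : ∀ {s} → Run s [] 0 s
  next : ∀ {s s₁ s₂ R Rs c c'} → Step R s c s₁ → Run s₁ Rs c' s₂ →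
         Run s (R ∷ Rs) (c + c') s₂

initial : ∀ {n} → List (Fin n) → State n
initial π₀ = ⟨ π₀ , (λ _ → 0ℚ) ⟩

-- DLM is analysed with a potential. With κ = 20r + 10, an element y at position p with budget β
-- contributes
--   φ(y) = κ·(p ∸ κ·σ(y)) + w·β,   w = 2 − 5r if y is misplaced (p ≥ 2κ·σ(y)), w = 2 otherwise,
-- where σ(y) is its position in the offline order, and Φ = Σ φ. Fetching the element z at position p
-- costs at most p − 1 swaps, resets φ(z) to 0 and raises the first term of the other elements by at
-- most p − 1 in total, since at most (p − 1)/κ elements y have κ·σ(y) ≤ p − 1. A cleanup fetch
-- (budget ≥ p) is therefore paid for by φ(z) ≥ 2(p − 1), and a request served at position ℓ costs
-- at most 5ℓ − φ(x) amortized, its charges (total ℓ, weight ≤ 2) included. If the σ-first element f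
-- of the request has ℓ < 2κ·σ(f), then 5ℓ ≤ 300r·σ(f), and σ(f) is the offline cost of the request;
-- otherwise f is misplaced, and either f = x and φ(x) ≥ 5ℓ, or f is charged ℓ/|R| at weight 2 − 5r,
-- which releases 5r·ℓ/|R| ≥ 5ℓ. Finally −5r·n² ≤ Φ throughout and Φ ≤ κ·n² initially, so DLM pays
-- at most 300r·Off + (κ + 5r)·n².

module Submission where

open import Defs
open import Algebra.Bundles using (CommutativeRing)
open import Function using (_∘′_; id)
open import Data.Bool using (if_then_else_)
open import Data.Fin using (Fin; zero; suc; _≟_)
open import Data.Fin.Properties using (suc-injective)
open import Data.Fin.Subset using (Subset; ∣_∣; Nonempty; inside; outside) renaming (_∈_ to _∈ₛ_)
open import Data.Fin.Subset.Properties using (_∈?_; ∣⁅x⁆∣≡1; x∈⁅y⁆⇒x≡y; p⊆q⇒∣p∣≤∣q∣)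
open import Data.Integer using (ℤ; 1ℤ)
import Data.Integer as ℤ
import Data.Integer.Tactic.RingSolver as ℤ-Solver
open import Data.List.Properties
  using (length-tabulate; length-++; filter-none; filter-all; filter-accept; filter-reject; filter-++)
open import Data.List using (List; []; _∷_; _++_; length; filter; map; tabulate; cartesianProduct; allFin)
open import Data.List.Membership.Propositional using (_∈_)
open import Data.List.Relation.Unary.All as All using (All; []; _∷_)
open import Data.List.Relation.Unary.Any using (here; there)
open import Data.List.Relation.Unary.AllPairs using ([]; _∷_)
open import Data.List.Relation.Unary.Unique.Propositional using (Unique)
open import Data.List.Relation.Unary.Unique.Propositional.Properties using (allFin⁺)
open import Data.List.Relation.Binary.Permutation.Propositional
  using (_↭_; ↭-refl; ↭-reflexive; ↭-prep; ↭-swap; ↭-sym; ↭-trans; ↭⇒↭ₛ; module PermutationReasoning)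
open import Data.List.Relation.Binary.Permutation.Propositional.Properties using (∈-resp-↭; ↭-length)
import Data.List.Relation.Binary.Permutation.Setoid.Properties as SetoidPermutation
open import Relation.Binary.PropositionalEquality.Properties using (setoid)
open import Data.List.Membership.Propositional.Properties using (∈-allFin)
open import Data.Nat as ℕ using (ℕ; zero; suc; z≤n; s≤s)
import Data.Nat.Properties as ℕ
import Data.Nat.Tactic.RingSolver as ℕ-Solver
open import Data.Product using (_×_; _,_; proj₁; proj₂; ∃-syntax)
open import Data.Rational using (ℚ; 0ℚ; 1ℚ; _+_; _*_; _-_; -_; _≤_; _<_; toℚᵘ; nonNegative)
open import Data.Rational.Properties hiding (_≟_)
import Data.Rational.Properties as ℚ
import Data.Rational.Unnormalised as ℚᵘ
import Data.Rational.Unnormalised.Properties as ℚᵘ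
open import Data.Sum using (_⊎_; inj₁; inj₂; [_,_]′)
open import Data.Vec using ([]; _∷_)
open import Level using (0ℓ)
open import Relation.Binary.PropositionalEquality
open import Relation.Binary.Definitions using (tri<; tri≈; tri>)
open import Relation.Nullary using (¬_; ¬?; Dec; yes; no; does; contradiction)
open import Relation.Nullary.Decidable using (dec⇒maybe; _×-dec_)
open import Relation.Unary using (Pred; Decidable)
open import Tactic.RingSolver using (solve-∀)
open import Tactic.RingSolver.Core.AlmostCommutativeRing using (AlmostCommutativeRing; fromCommutativeRing)

open import Algebra.Properties.Semiring.Mult (CommutativeRing.semiring +-*-commutativeRing)
  using (×1-homo-*; ×-homo-+) renaming (_×_ to _×ℚ_)
open import Algebra.Properties.Semiring.Sum (CommutativeRing.semiring +-*-commutativeRing)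
  using (sum-syntax; ∑-distrib-+; *-distribˡ-sum)

count : ∀ {A : Set} {P : Pred A 0ℓ} → Decidable P → List A → ℕ
count P? xs = length (filter P? xs)

module _ {A : Set} {P Q R : Pred A 0ℓ} (P? : Decidable P) (Q? : Decidable Q) (R? : Decidable R) where

  count-≤-⊎ : (∀ {a} → P a → Q a ⊎ R a) → ∀ xs → count P? xs ℕ.≤ count Q? xs ℕ.+ count R? xs
  count-≤-⊎ P⇒Q⊎R [] = z≤n
  count-≤-⊎ P⇒Q⊎R (x ∷ xs) with ih ← count-≤-⊎ P⇒Q⊎R xs | P? x | Q? x | R? x
  ... | yes _  | yes _ | yes _ = s≤s (ℕ.≤-trans ih (ℕ.+-monoʳ-≤ _ (ℕ.n≤1+n _)))
  ... | yes _  | yes _ | no _  = s≤s ih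
  ... | yes _  | no _  | yes _ = ℕ.≤-trans (s≤s ih) (ℕ.≤-reflexive (sym (ℕ.+-suc _ _)))
  ... | yes px | no ¬q | no ¬r = contradiction (P⇒Q⊎R px) [ ¬q , ¬r ]′
  ... | no _   | yes _ | yes _ = ℕ.≤-trans ih (ℕ.+-mono-≤ (ℕ.n≤1+n _) (ℕ.n≤1+n _))
  ... | no _   | yes _ | no _  = ℕ.≤-trans ih (ℕ.n≤1+n _)
  ... | no _   | no _  | yes _ = ℕ.≤-trans ih (ℕ.+-monoʳ-≤ _ (ℕ.n≤1+n _))
  ... | no _   | no _  | no _  = ih

module _ {A : Set} {P Q : Pred A 0ℓ} (P? : Decidable P) (Q? : Decidable Q) where

  count-mono : (∀ {a} → P a → Q a) → ∀ xs → count P? xs ℕ.≤ count Q? xs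
  count-mono P⇒Q [] = z≤n
  count-mono P⇒Q (x ∷ xs) with ih ← count-mono P⇒Q xs | P? x | Q? x
  ... | yes _  | yes _ = s≤s ih
  ... | yes px | no ¬q = contradiction (P⇒Q px) ¬q
  ... | no _   | yes _ = ℕ.≤-trans ih (ℕ.n≤1+n _)
  ... | no _   | no _  = ih

module _ {A : Set} {P : Pred A 0ℓ} (P? : Decidable P) where

  count-none : (∀ {a} → ¬ P a) → ∀ xs → count P? xs ≡ 0
  count-none ¬P xs = cong length (filter-none P? (All.universal (λ _ → ¬P) xs))

  count-++ : ∀ xs ys → count P? (xs ++ ys) ≡ count P? xs ℕ.+ count P? ys
  count-++ xs ys = trans (cong length (filter-++ P? xs ys)) (length-++ (filter P? xs))

  count-map : ∀ {B : Set} (f : B → A) xs → count P? (map f xs) ≡ count (λ b → P? (f b)) xs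
  count-map f [] = refl
  count-map f (x ∷ xs) with P? (f x)
  ... | yes _ = cong suc (count-map f xs)
  ... | no _  = count-map f xs

module _ {A B : Set} {P : Pred (A × B) 0ℓ} {Q : Pred A 0ℓ} {R : Pred B 0ℓ}
         (P? : Decidable P) (Q? : Decidable Q) (R? : Decidable R) where

  count-cartesianProduct : (∀ {a b} → P (a , b) → Q a × R b) →
                           ∀ xs ys → count P? (cartesianProduct xs ys) ℕ.≤ count Q? xs ℕ.* count R? ys
  count-cartesianProduct P⇒Q×R [] ys = z≤n
  count-cartesianProduct P⇒Q×R (x ∷ xs) ys = begin
    count P? (map (x ,_) ys ++ cartesianProduct xs ys)
      ≡⟨ count-++ P? (map (x ,_) ys) _ ⟩
    count P? (map (x ,_) ys) ℕ.+ count P? (cartesianProduct xs ys)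
      ≡⟨ cong (ℕ._+ _) (count-map P? (x ,_) ys) ⟩
    count (λ y → P? (x , y)) ys ℕ.+ count P? (cartesianProduct xs ys)
      ≤⟨ first-row (count-cartesianProduct P⇒Q×R xs ys) ⟩
    count Q? (x ∷ xs) ℕ.* count R? ys ∎
    where
    open ℕ.≤-Reasoning
    first-row : count P? (cartesianProduct xs ys) ℕ.≤ count Q? xs ℕ.* count R? ys →
          count (λ y → P? (x , y)) ys ℕ.+ count P? (cartesianProduct xs ys) ℕ.≤ count Q? (x ∷ xs) ℕ.* count R? ys
    first-row ih with Q? x
    ... | yes _  = ℕ.+-mono-≤ (count-mono _ R? (λ p → proj₂ (P⇒Q×R p)) ys) ih
    ... | no ¬q = subst (ℕ._≤ _) (cong (ℕ._+ _) (sym (count-none _ (λ p → ¬q (proj₁ (P⇒Q×R p))) ys))) ih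

count-≡-≤1 : ∀ {n} (x : Fin n) {ys} → Unique ys → count (x ≟_) ys ℕ.≤ 1
count-≡-≤1 x [] = z≤n
count-≡-≤1 x {y ∷ ys} (y∉ys ∷ u) with x ≟ y
... | yes refl = s≤s (ℕ.≤-reflexive (cong length (filter-none (x ≟_) y∉ys)))
... | no _     = count-≡-≤1 x u

-- Positions

module _ {n : ℕ} where

  pos>0 : ∀ (xs : List (Fin n)) z → 0 ℕ.< pos xs z
  pos>0 []       z = s≤s z≤n
  pos>0 (x ∷ xs) z with x ≟ z
  ... | yes _ = s≤s z≤n
  ... | no _  = s≤s z≤n

  pos≤length : ∀ {xs : List (Fin n)} {z} → z ∈ xs → pos xs z ℕ.≤ length xs
  pos≤length {x ∷ xs} {z} z∈ with x ≟ z | z∈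
  ... | yes _   | _          = s≤s z≤n
  ... | no x≢z  | here z≡x   = contradiction (sym z≡x) x≢z
  ... | no _    | there z∈xs = s≤s (pos≤length z∈xs)

  pos-injective : ∀ {xs : List (Fin n)} {y z} → z ∈ xs → pos xs y ≡ pos xs z → y ≡ z
  pos-injective {x ∷ xs} {y} {z} z∈ eq with x ≟ y | x ≟ z | z∈
  ... | yes x≡y | yes x≡z | _          = trans (sym x≡y) x≡z
  ... | yes _   | no _    | _          = contradiction (ℕ.suc-injective eq) (ℕ.<⇒≢ (pos>0 xs z))
  ... | no _    | yes _   | _          = contradiction (sym (ℕ.suc-injective eq)) (ℕ.<⇒≢ (pos>0 xs y))
  ... | no _    | no x≢z  | here z≡x   = contradiction (sym z≡x) x≢z
  ... | no _    | no _    | there z∈xs = pos-injective z∈xs (ℕ.suc-injective eq)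

  pos-head : ∀ (x : Fin n) xs → pos (x ∷ xs) x ≡ 1
  pos-head x xs with x ≟ x
  ... | yes _   = refl
  ... | no x≢x = contradiction refl x≢x

  pos-cons-≢ : ∀ {x y : Fin n} xs → x ≢ y → pos (x ∷ xs) y ≡ suc (pos xs y)
  pos-cons-≢ {x} {y} xs x≢y with x ≟ y
  ... | yes x≡y = contradiction x≡y x≢y
  ... | no _    = refl

  remove : Fin n → List (Fin n) → List (Fin n)
  remove z = filter (λ y → ¬? (y ≟ z))

  toFront : Fin n → List (Fin n) → List (Fin n)
  toFront z xs = z ∷ remove z xs

  pos-remove-before : ∀ (xs : List (Fin n)) {y z} → pos xs y ℕ.< pos xs z → pos (remove z xs) y ≡ pos xs y
  pos-remove-before []       (s≤s ())
  pos-remove-before (x ∷ xs) {y} {z} y<z with x ≟ z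
  ... | yes refl with x ≟ y
  ...   | yes _ = contradiction y<z (ℕ.<-irrefl refl)
  ...   | no _  = contradiction (ℕ.≤-pred y<z) ℕ.n≮0
  pos-remove-before (x ∷ xs) {y} {z} y<z | no _ with x ≟ y
  ...   | yes _ = refl
  ...   | no _  = cong suc (pos-remove-before xs (ℕ.≤-pred y<z))

  pos-remove-after : ∀ (xs : List (Fin n)) {y z} → Unique xs → pos xs z ℕ.< pos xs y →
                     suc (pos (remove z xs) y) ≡ pos xs y
  pos-remove-after []       _ (s≤s ())
  pos-remove-after (x ∷ xs) {y} {z} (x∉xs ∷ _) z<y with x ≟ z
  ... | yes refl with x ≟ y
  ...   | yes _ = contradiction z<y (ℕ.<-irrefl refl)
  ...   | no _  = cong (λ ws → suc (pos ws y)) (filter-all (λ w → ¬? (w ≟ x)) (All.map ≢-sym x∉xs))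
  pos-remove-after (x ∷ xs) {y} {z} (_ ∷ u) z<y | no _ with x ≟ y
  ...   | yes _ = contradiction (ℕ.≤-pred z<y) ℕ.n≮0
  ...   | no _  = cong suc (pos-remove-after xs u (ℕ.≤-pred z<y))

  pos-toFront-self : ∀ z xs → pos (toFront z xs) z ≡ 1
  pos-toFront-self z xs = pos-head z (remove z xs)

  pos-toFront : ∀ {xs y z} → Unique xs → z ∈ xs → y ≢ z →
                (pos xs y ℕ.< pos xs z × pos (toFront z xs) y ≡ suc (pos xs y)) ⊎
                (pos xs z ℕ.< pos xs y × pos (toFront z xs) y ≡ pos xs y)
  pos-toFront {xs} {y} {z} u z∈xs y≢z with z ≟ y
  ... | yes z≡y = contradiction (sym z≡y) y≢z
  ... | no _ with ℕ.<-cmp (pos xs y) (pos xs z)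
  ...   | tri< y<z _ _ = inj₁ (y<z , cong suc (pos-remove-before xs y<z))
  ...   | tri≈ _ eq _  = contradiction (pos-injective z∈xs eq) y≢z
  ...   | tri> _ _ z<y = inj₂ (z<y , pos-remove-after xs u z<y)

  pos≤pos-toFront : ∀ {xs y z} → Unique xs → z ∈ xs → y ≢ z → pos xs y ℕ.≤ pos (toFront z xs) y
  pos≤pos-toFront u z∈xs y≢z with pos-toFront u z∈xs y≢z
  ... | inj₁ (_ , eq) = ℕ.≤-trans (ℕ.n≤1+n _) (ℕ.≤-reflexive (sym eq))
  ... | inj₂ (_ , eq) = ℕ.≤-reflexive (sym eq)

  ↭allFin⇒Unique : ∀ {xs} → xs ↭ allFin n → Unique xs
  ↭allFin⇒Unique xs↭ = SetoidPermutation.Unique-resp-↭ (setoid (Fin n)) (↭⇒↭ₛ (↭-sym xs↭)) (allFin⁺ n)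

  ↭allFin⇒∈ : ∀ {xs} → xs ↭ allFin n → ∀ z → z ∈ xs
  ↭allFin⇒∈ xs↭ z = ∈-resp-↭ (↭-sym xs↭) (∈-allFin z)

  ↭allFin⇒length : ∀ {xs} → xs ↭ allFin n → length xs ≡ n
  ↭allFin⇒length xs↭ = trans (↭-length xs↭) (length-tabulate id)

  toFront-↭ : ∀ {xs z} → Unique xs → z ∈ xs → toFront z xs ↭ xs
  toFront-↭ {x ∷ xs} (x∉xs ∷ _) (here refl) =
    ↭-prep x (↭-reflexive (trans (filter-reject (λ w → ¬? (w ≟ x)) (λ x≢x → x≢x refl))
                            (filter-all (λ w → ¬? (w ≟ x)) (All.map ≢-sym x∉xs))))
  toFront-↭ {x ∷ xs} {z} (x∉xs ∷ u) (there z∈xs) = begin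
    z ∷ remove z (x ∷ xs)  ≡⟨ cong (z ∷_) (filter-accept (λ w → ¬? (w ≟ z)) (All.lookup x∉xs z∈xs)) ⟩
    z ∷ x ∷ remove z xs    ↭⟨ ↭-swap z x ↭-refl ⟩
    x ∷ z ∷ remove z xs    ↭⟨ ↭-prep x (toFront-↭ u z∈xs) ⟩
    x ∷ xs                 ∎
    where open PermutationReasoning

  count-early : ∀ κ (L : List (Fin n)) m {ys} → Unique ys → m ℕ.< κ ℕ.* suc (length L) →
                κ ℕ.* count (λ y → κ ℕ.* pos L y ℕ.≤? m) ys ℕ.≤ m
  count-early κ L m {ys} u bound with m ℕ.<? κ
  ... | yes m<κ = ℕ.≤-trans (ℕ.≤-reflexive (trans (cong (κ ℕ.*_) none) (ℕ.*-zeroʳ κ))) z≤n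
    where
    none : count (λ y → κ ℕ.* pos L y ℕ.≤? m) ys ≡ 0
    none = count-none _ (λ {y} κpos≤m → ℕ.<⇒≱ m<κ (ℕ.≤-trans (κ≤κ*pos y) κpos≤m)) ys
      where
      κ≤κ*pos : ∀ y → κ ℕ.≤ κ ℕ.* pos L y
      κ≤κ*pos y = ℕ.m≤m*n κ (pos L y) {{ℕ.>-nonZero (pos>0 L y)}}
  count-early κ []      m u bound | no m≮κ = contradiction (subst (m ℕ.<_) (ℕ.*-identityʳ κ) bound) m≮κ
  count-early κ (x ∷ L) m {ys} u bound | no m≮κ = begin
    κ ℕ.* count P? ys
      ≤⟨ ℕ.*-monoʳ-≤ κ (count-≤-⊎ P? (x ≟_) Q? split ys) ⟩
    κ ℕ.* (count (x ≟_) ys ℕ.+ count Q? ys)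
      ≤⟨ ℕ.*-monoʳ-≤ κ (ℕ.+-monoˡ-≤ _ (count-≡-≤1 x u)) ⟩
    κ ℕ.* suc (count Q? ys)
      ≡⟨ ℕ.*-suc κ _ ⟩
    κ ℕ.+ κ ℕ.* count Q? ys
      ≤⟨ ℕ.+-monoʳ-≤ κ (count-early κ L (m ℕ.∸ κ) u bound′) ⟩
    κ ℕ.+ (m ℕ.∸ κ)
      ≡⟨ ℕ.m+[n∸m]≡n κ≤m ⟩
    m                                                   ∎
    where
    open ℕ.≤-Reasoning
    κ≤m = ℕ.≮⇒≥ m≮κ
    P? = λ y → κ ℕ.* pos (x ∷ L) y ℕ.≤? m
    Q? = λ y → κ ℕ.* pos L y ℕ.≤? m ℕ.∸ κ
    split : ∀ {y} → κ ℕ.* pos (x ∷ L) y ℕ.≤ m → x ≡ y ⊎ κ ℕ.* pos L y ℕ.≤ m ℕ.∸ κ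
    split {y} κpos≤m with x ≟ y
    ... | yes x≡y = inj₁ x≡y
    ... | no _    =
      inj₂ (subst (ℕ._≤ m ℕ.∸ κ) (ℕ.m+n∸m≡n κ _) (ℕ.∸-monoˡ-≤ κ (subst (ℕ._≤ m) (ℕ.*-suc κ _) κpos≤m)))
    bound′ : m ℕ.∸ κ ℕ.< κ ℕ.* suc (length L)
    bound′ = subst (m ℕ.∸ κ ℕ.<_) (ℕ.m+n∸m≡n κ _) (ℕ.∸-monoˡ-< (subst (m ℕ.<_) (ℕ.*-suc κ _) bound) κ≤m)

  accessCost-witness : ∀ {L : List (Fin n)} {R z} → z ∈ₛ R → z ∈ L →
                       ∃[ f ] f ∈ₛ R × pos L f ℕ.≤ accessCost L R
  accessCost-witness {x ∷ xs} {R} z∈R z∈L with x ∈? R | z∈L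
  ... | yes x∈R | _          = x , x∈R , ℕ.≤-reflexive (pos-head x xs)
  ... | no x∉R  | here z≡x   = contradiction (subst (_∈ₛ R) z≡x z∈R) x∉R
  ... | no x∉R  | there z∈xs with accessCost-witness z∈R z∈xs
  ...   | f , f∈R , f≤acc =
    f , f∈R , ℕ.≤-trans (ℕ.≤-reflexive (pos-cons-≢ xs λ x≡f → x∉R (subst (_∈ₛ R) (sym x≡f) f∈R))) (s≤s f≤acc)

-- Swap distance

module _ {n : ℕ} where

  Inverted : List (Fin n) → List (Fin n) → Pred (Fin n × Fin n) 0ℓ
  Inverted xs ys p = pos xs (proj₁ p) ℕ.< pos xs (proj₂ p) × pos ys (proj₂ p) ℕ.< pos ys (proj₁ p)

  inverted? : ∀ xs ys → Decidable (Inverted xs ys)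
  inverted? xs ys p = (pos xs (proj₁ p) ℕ.<? pos xs (proj₂ p)) ×-dec (pos ys (proj₂ p) ℕ.<? pos ys (proj₁ p))

  swapDist-self : ∀ xs → swapDist xs xs ≡ 0
  swapDist-self xs =
    count-none (inverted? xs xs) (λ (a<b , b<a) → ℕ.<-asym a<b b<a) (cartesianProduct (allFin n) (allFin n))

  swapDist-triangle : ∀ xs {ys} zs → (∀ z → z ∈ ys) →
                      swapDist xs zs ℕ.≤ swapDist xs ys ℕ.+ swapDist ys zs
  swapDist-triangle xs {ys} zs complete = count-≤-⊎ (inverted? xs zs) (inverted? xs ys) (inverted? ys zs) split
                                                  (cartesianProduct (allFin n) (allFin n))
    where
    split : ∀ {p} → Inverted xs zs p → Inverted xs ys p ⊎ Inverted ys zs p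
    split {a , b} (a<b , b<a) with ℕ.<-cmp (pos ys a) (pos ys b)
    ... | tri< a<b′ _ _ = inj₂ (a<b′ , b<a)
    ... | tri≈ _ eq _   = contradiction (cong (pos xs) (pos-injective (complete b) eq)) (ℕ.<⇒≢ a<b)
    ... | tri> _ _ b<a′ = inj₁ (a<b , b<a′)

  swapDist-toFront : ∀ {xs z} → Unique xs → z ∈ xs → swapDist xs (toFront z xs) ℕ.≤ pos xs z ℕ.∸ 1
  swapDist-toFront {xs} {z} u z∈xs = begin
    swapDist xs (toFront z xs)
      ≤⟨ count-cartesianProduct (inverted? xs (toFront z xs)) Q? (z ≟_) only-z (allFin n) (allFin n) ⟩
    count Q? (allFin n) ℕ.* count (z ≟_) (allFin n)
      ≤⟨ ℕ.*-monoʳ-≤ (count Q? (allFin n)) (count-≡-≤1 z (allFin⁺ n)) ⟩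
    count Q? (allFin n) ℕ.* 1
      ≡⟨ ℕ.*-comm _ 1 ⟩
    1 ℕ.* count Q? (allFin n)
      ≤⟨ count-early 1 xs (pos xs z ℕ.∸ 1) (allFin⁺ n) bound ⟩
    pos xs z ℕ.∸ 1                           ∎
    where
    open ℕ.≤-Reasoning
    t = toFront z xs
    Q? = λ a → 1 ℕ.* pos xs a ℕ.≤? pos xs z ℕ.∸ 1
    bound : pos xs z ℕ.∸ 1 ℕ.< 1 ℕ.* suc (length xs)
    bound = subst (pos xs z ℕ.∸ 1 ℕ.<_) (sym (ℕ.*-identityˡ _))
              (s≤s (ℕ.≤-trans (ℕ.m∸n≤m _ 1) (pos≤length z∈xs)))
    before-z : ∀ {a} → pos xs a ℕ.< pos xs z → 1 ℕ.* pos xs a ℕ.≤ pos xs z ℕ.∸ 1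
    before-z {a} a<z = subst (ℕ._≤ pos xs z ℕ.∸ 1) (sym (ℕ.*-identityˡ _)) (ℕ.∸-monoˡ-≤ 1 a<z)
    only-z : ∀ {a b} → Inverted xs t (a , b) → 1 ℕ.* pos xs a ℕ.≤ pos xs z ℕ.∸ 1 × z ≡ b
    only-z {a} {b} (a<b , b<ₜa) = cases (z ≟ b) (z ≟ a)
      where
      cases : Dec (z ≡ b) → Dec (z ≡ a) → 1 ℕ.* pos xs a ℕ.≤ pos xs z ℕ.∸ 1 × z ≡ b
      cases (yes z≡b) _         = before-z (subst (λ w → pos xs a ℕ.< pos xs w) (sym z≡b) a<b) , z≡b
      cases (no _)    (yes z≡a) = contradiction (pos>0 t b)
        (ℕ.<⇒≱ (subst (pos t b ℕ.<_) (trans (cong (pos t) (sym z≡a)) (pos-toFront-self z xs)) b<ₜa))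
      cases (no z≢b)  (no z≢a)  with pos-toFront u z∈xs (≢-sym z≢a) | pos-toFront u z∈xs (≢-sym z≢b)
      ... | inj₁ (_ , ta)   | inj₁ (_ , tb)   = contradiction (subst₂ ℕ._<_ tb ta b<ₜa) (ℕ.<⇒≯ (s≤s a<b))
      ... | inj₁ (a<z , ta) | inj₂ (z<b , tb) =
        contradiction (ℕ.≤-pred (subst₂ ℕ._<_ tb ta b<ₜa)) (ℕ.<⇒≱ (ℕ.<-trans a<z z<b))
      ... | inj₂ (z<a , _)  | inj₁ (b<z , _)  = contradiction (ℕ.<-trans b<z z<a) (ℕ.<⇒≯ a<b)
      ... | inj₂ (_ , ta)   | inj₂ (_ , tb)   = contradiction (subst₂ ℕ._<_ tb ta b<ₜa) (ℕ.<⇒≯ a<b)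

  swapDist-via-toFront : ∀ {xs} z ys → xs ↭ allFin n →
                         swapDist xs ys ℕ.≤ (pos xs z ℕ.∸ 1) ℕ.+ swapDist (toFront z xs) ys
  swapDist-via-toFront {xs} z ys xs↭ = ℕ.≤-trans (swapDist-triangle xs ys complete)
    (ℕ.+-monoˡ-≤ (swapDist (toFront z xs) ys) (swapDist-toFront (↭allFin⇒Unique xs↭) (↭allFin⇒∈ xs↭ z)))
    where
    complete : ∀ y → y ∈ toFront z xs
    complete y = ∈-resp-↭ (↭-sym (toFront-↭ (↭allFin⇒Unique xs↭) (↭allFin⇒∈ xs↭ z))) (↭allFin⇒∈ xs↭ y)

ℚ-ring : AlmostCommutativeRing 0ℓ 0ℓ
ℚ-ring = fromCommutativeRing +-*-commutativeRing (λ x → dec⇒maybe (0ℚ ℚ.≟ x))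

p≤p+q : ∀ {p q} → 0ℚ ≤ q → p ≤ p + q
p≤p+q {p} {q} 0≤q = subst (_≤ p + q) (+-identityʳ p) (+-monoʳ-≤ p 0≤q)

p≤q+p : ∀ {p q} → 0ℚ ≤ q → p ≤ q + p
p≤q+p {p} {q} 0≤q = subst (_≤ q + p) (+-identityˡ p) (+-monoˡ-≤ p 0≤q)

+-cancelʳ-≤ : ∀ {p q} r → p + r ≤ q + r → p ≤ q
+-cancelʳ-≤ {p} {q} r p+r≤q+r = subst₂ _≤_ (cancel p r) (cancel q r) (+-monoˡ-≤ (- r) p+r≤q+r)
  where
  cancel : ∀ x y → x + y - y ≡ x
  cancel = solve-∀ ℚ-ring

*-monoˡ-≤-0≤ : ∀ {r p q} → 0ℚ ≤ r → p ≤ q → r * p ≤ r * q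
*-monoˡ-≤-0≤ {r} 0≤r = *-monoˡ-≤-nonNeg r {{nonNegative 0≤r}}

*-monoʳ-≤-0≤ : ∀ {r p q} → 0ℚ ≤ r → p ≤ q → p * r ≤ q * r
*-monoʳ-≤-0≤ {r} 0≤r = *-monoʳ-≤-nonNeg r {{nonNegative 0≤r}}

0≤* : ∀ {p q} → 0ℚ ≤ p → 0ℚ ≤ q → 0ℚ ≤ p * q
0≤* {p} 0≤p 0≤q = subst (_≤ p * _) (*-zeroʳ p) (*-monoˡ-≤-0≤ 0≤p 0≤q)

telescope : ∀ a w p₃ p₂ b p₁ t f p₀ l → w + p₃ ≤ p₂ → p₂ + b ≤ p₁ + t → p₁ + f ≤ p₀ + l →
            a + w + p₃ + (f + b) ≤ p₀ + (a + t + l)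
telescope a w p₃ p₂ b p₁ t f p₀ l w+p₃≤p₂ p₂+b≤p₁+t p₁+f≤p₀+l = begin
  a + w + p₃ + (f + b)     ≡⟨ regroup₁ a w p₃ f b ⟩
  a + f + (w + p₃) + b     ≤⟨ +-monoˡ-≤ b (+-monoʳ-≤ (a + f) w+p₃≤p₂) ⟩
  a + f + p₂ + b           ≡⟨ +-assoc (a + f) p₂ b ⟩
  a + f + (p₂ + b)         ≤⟨ +-monoʳ-≤ (a + f) p₂+b≤p₁+t ⟩
  a + f + (p₁ + t)         ≡⟨ regroup₂ a f p₁ t ⟩
  a + t + (p₁ + f)         ≤⟨ +-monoʳ-≤ (a + t) p₁+f≤p₀+l ⟩
  a + t + (p₀ + l)         ≡⟨ regroup₃ a t p₀ l ⟩
  p₀ + (a + t + l)         ∎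
  where
  open ≤-Reasoning
  regroup₁ : ∀ a w p f b → a + w + p + (f + b) ≡ a + f + (w + p) + b
  regroup₁ = solve-∀ ℚ-ring
  regroup₂ : ∀ a f p t → a + f + (p + t) ≡ a + t + (p + f)
  regroup₂ = solve-∀ ℚ-ring
  regroup₃ : ∀ a t p l → a + t + (p + l) ≡ p + (a + t + l)
  regroup₃ = solve-∀ ℚ-ring

amortize-trans : ∀ a b A B x y z → a + y ≤ A + x → b + z ≤ B + y → a + b + z ≤ A + B + x
amortize-trans a b A B x y z a+y≤A+x b+z≤B+y = begin
  a + b + z       ≡⟨ +-assoc a b z ⟩
  a + (b + z)     ≤⟨ +-monoʳ-≤ a b+z≤B+y ⟩
  a + (B + y)     ≡⟨ regroup₁ a B y ⟩
  B + (a + y)     ≤⟨ +-monoʳ-≤ B a+y≤A+x ⟩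
  B + (A + x)     ≡⟨ regroup₂ B A x ⟩
  A + B + x       ∎
  where
  open ≤-Reasoning
  regroup₁ : ∀ a b y → a + (b + y) ≡ b + (a + y)
  regroup₁ = solve-∀ ℚ-ring
  regroup₂ : ∀ b a x → b + (a + x) ≡ a + b + x
  regroup₂ = solve-∀ ℚ-ring

ℕtoℚ-suc : ∀ k → ℕtoℚ (suc k) ≡ 1ℚ + ℕtoℚ k
ℕtoℚ-suc k = toℚᵘ-injective (ℚᵘ.≃-sym (begin
  toℚᵘ (1ℚ + ℕtoℚ k)                ≈⟨ toℚᵘ-homo-+ 1ℚ (ℕtoℚ k) ⟩
  toℚᵘ 1ℚ ℚᵘ.+ toℚᵘ (ℕtoℚ k)          ≈⟨ ℚᵘ.+-congʳ (toℚᵘ 1ℚ) (toℚᵘ-fromℚᵘ (ℚᵘ.mkℚᵘ (ℤ.+ k) 0)) ⟩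
  toℚᵘ 1ℚ ℚᵘ.+ ℚᵘ.mkℚᵘ (ℤ.+ k) 0      ≈⟨ ℚᵘ.*≡* (cross (ℤ.+ k)) ⟩
  ℚᵘ.mkℚᵘ (ℤ.+ suc k) 0               ≈⟨ toℚᵘ-fromℚᵘ (ℚᵘ.mkℚᵘ (ℤ.+ suc k) 0) ⟨
  toℚᵘ (ℕtoℚ (suc k))               ∎))
  where
  open ℚᵘ.≃-Reasoning
  cross : ∀ (x : ℤ) → (1ℤ ℤ.* 1ℤ ℤ.+ x ℤ.* 1ℤ) ℤ.* 1ℤ ≡ (1ℤ ℤ.+ x) ℤ.* (1ℤ ℤ.* 1ℤ)
  cross = ℤ-Solver.solve-∀

ℕtoℚ≡×1ℚ : ∀ k → ℕtoℚ k ≡ k ×ℚ 1ℚ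
ℕtoℚ≡×1ℚ zero    = refl
ℕtoℚ≡×1ℚ (suc k) = trans (ℕtoℚ-suc k) (cong (1ℚ +_) (ℕtoℚ≡×1ℚ k))

ℕtoℚ-+ : ∀ m n → ℕtoℚ (m ℕ.+ n) ≡ ℕtoℚ m + ℕtoℚ n
ℕtoℚ-+ m n rewrite ℕtoℚ≡×1ℚ m | ℕtoℚ≡×1ℚ n | ℕtoℚ≡×1ℚ (m ℕ.+ n) = ×-homo-+ 1ℚ m n

ℕtoℚ-* : ∀ m n → ℕtoℚ (m ℕ.* n) ≡ ℕtoℚ m * ℕtoℚ n
ℕtoℚ-* m n rewrite ℕtoℚ≡×1ℚ m | ℕtoℚ≡×1ℚ n | ℕtoℚ≡×1ℚ (m ℕ.* n) = ×1-homo-* m n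

0≤ℕtoℚ : ∀ k → 0ℚ ≤ ℕtoℚ k
0≤ℕtoℚ k = nonNegative⁻¹ (ℕtoℚ k) {{normalize-nonNeg k 1}}

ℕtoℚ-mono-≤ : ∀ {m n} → m ℕ.≤ n → ℕtoℚ m ≤ ℕtoℚ n
ℕtoℚ-mono-≤ {m} {n} m≤n = begin
  ℕtoℚ m                    ≤⟨ p≤p+q (0≤ℕtoℚ (n ℕ.∸ m)) ⟩
  ℕtoℚ m + ℕtoℚ (n ℕ.∸ m)   ≡⟨ ℕtoℚ-+ m (n ℕ.∸ m) ⟨
  ℕtoℚ (m ℕ.+ (n ℕ.∸ m))    ≡⟨ cong ℕtoℚ (ℕ.m+[n∸m]≡n m≤n) ⟩
  ℕtoℚ n                    ∎
  where open ≤-Reasoning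

ℕtoℚ-cancel-≤ : ∀ {m n} → ℕtoℚ m ≤ ℕtoℚ n → m ℕ.≤ n
ℕtoℚ-cancel-≤ {m} {n} ℕtoℚm≤ℕtoℚn with m ℕ.≤? n
... | yes m≤n = m≤n
... | no m≰n  =
  contradiction (<-≤-trans n<1+n (≤-trans (ℕtoℚ-mono-≤ (ℕ.≰⇒> m≰n)) ℕtoℚm≤ℕtoℚn)) (<-irrefl refl)
  where
  n<1+n : ℕtoℚ n < ℕtoℚ (suc n)
  n<1+n = subst₂ _<_ (+-identityˡ (ℕtoℚ n)) (sym (ℕtoℚ-suc n)) (+-mono-<-≤ (positive⁻¹ 1ℚ) (≤-refl {ℕtoℚ n}))

0≤share : ∀ ℓ s → 0ℚ ≤ share ℓ s
0≤share ℓ zero    = ≤-refl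
0≤share ℓ (suc k) = nonNegative⁻¹ _ {{normalize-nonNeg ℓ (suc k)}}

share-* : ∀ ℓ {s} → 0 ℕ.< s → ℕtoℚ s * share ℓ s ≡ ℕtoℚ ℓ
share-* ℓ {suc k} _ = toℚᵘ-injective (begin
  toℚᵘ (ℕtoℚ (suc k) * share ℓ (suc k))
    ≈⟨ toℚᵘ-homo-* (ℕtoℚ (suc k)) (share ℓ (suc k)) ⟩
  toℚᵘ (ℕtoℚ (suc k)) ℚᵘ.* toℚᵘ (share ℓ (suc k))
    ≈⟨ ℚᵘ.*-cong (toℚᵘ-fromℚᵘ (ℚᵘ.mkℚᵘ (ℤ.+ suc k) 0)) (toℚᵘ-fromℚᵘ (ℚᵘ.mkℚᵘ (ℤ.+ ℓ) k)) ⟩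
  ℚᵘ.mkℚᵘ (ℤ.+ suc k) 0 ℚᵘ.* ℚᵘ.mkℚᵘ (ℤ.+ ℓ) k
    ≈⟨ ℚᵘ.*≡* (cross (ℤ.+ suc k) (ℤ.+ ℓ)) ⟩
  ℚᵘ.mkℚᵘ (ℤ.+ ℓ) 0
    ≈⟨ toℚᵘ-fromℚᵘ (ℚᵘ.mkℚᵘ (ℤ.+ ℓ) 0) ⟨
  toℚᵘ (ℕtoℚ ℓ)                                         ∎)
  where
  open ℚᵘ.≃-Reasoning
  cross : ∀ (x y : ℤ) → (x ℤ.* y) ℤ.* 1ℤ ≡ y ℤ.* (1ℤ ℤ.* x)
  cross = ℤ-Solver.solve-∀

-- Through does, so that 𝟙 (suc i ∈? p) computes to 𝟙 (i ∈? p).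
𝟙 : ∀ {P : Set} → Dec P → ℚ
𝟙 d = if does d then 1ℚ else 0ℚ

𝟙-yes : ∀ {P : Set} (d : Dec P) → P → 𝟙 d ≡ 1ℚ
𝟙-yes (yes _) _ = refl
𝟙-yes (no ¬p) p = contradiction p ¬p

𝟙-no : ∀ {P : Set} (d : Dec P) → ¬ P → 𝟙 d ≡ 0ℚ
𝟙-no (yes p) ¬p = contradiction p ¬p
𝟙-no (no _)  _  = refl

0≤𝟙 : ∀ {P : Set} (d : Dec P) → 0ℚ ≤ 𝟙 d
0≤𝟙 (yes _) = <⇒≤ (positive⁻¹ 1ℚ)
0≤𝟙 (no _)  = ≤-refl

𝟙-mono : ∀ {P Q : Set} (d : Dec P) (e : Dec Q) → (P → Q) → 𝟙 d ≤ 𝟙 e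
𝟙-mono (yes p) e P⇒Q = ≤-reflexive (sym (𝟙-yes e (P⇒Q p)))
𝟙-mono (no _)  e _   = 0≤𝟙 e

∑-mono : ∀ {n} {f g : Fin n → ℚ} → (∀ i → f i ≤ g i) → ∑[ i < n ] f i ≤ ∑[ i < n ] g i
∑-mono {zero}  f≤g = ≤-refl
∑-mono {suc n} f≤g = +-mono-≤ (f≤g zero) (∑-mono (λ i → f≤g (suc i)))

∑-mono-except : ∀ {n} (z : Fin n) {f g : Fin n → ℚ} {c} → (∀ i → i ≢ z → f i ≤ g i) → f z + c ≤ g z →
                ∑[ i < n ] f i + c ≤ ∑[ i < n ] g i
∑-mono-except {suc n} zero {f} {g} {c} f≤g fz+c≤gz = begin
  f zero + ∑[ i < n ] f (suc i) + c ≡⟨ swap (f zero) _ c ⟩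
  f zero + c + ∑[ i < n ] f (suc i) ≤⟨ +-mono-≤ fz+c≤gz (∑-mono (λ i → f≤g (suc i) λ ())) ⟩
  g zero + ∑[ i < n ] g (suc i)     ∎
  where
  open ≤-Reasoning
  swap : ∀ x y z → x + y + z ≡ x + z + y
  swap = solve-∀ ℚ-ring
∑-mono-except {suc n} (suc z) {f} {g} {c} f≤g fz+c≤gz = begin
  f zero + ∑[ i < n ] f (suc i) + c
    ≡⟨ +-assoc (f zero) _ c ⟩
  f zero + (∑[ i < n ] f (suc i) + c)
    ≤⟨ +-mono-≤ (f≤g zero λ ()) (∑-mono-except z (λ i i≢z → f≤g (suc i) (i≢z ∘′ suc-injective)) fz+c≤gz) ⟩
  g zero + ∑[ i < n ] g (suc i)       ∎
  where open ≤-Reasoning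

∑-const : ∀ n c → ∑[ i < n ] c ≡ ℕtoℚ n * c
∑-const zero    c = sym (*-zeroˡ c)
∑-const (suc n) c = begin
  c + ∑[ i < n ] c    ≡⟨ cong (c +_) (∑-const n c) ⟩
  c + ℕtoℚ n * c      ≡⟨ cong (_+ ℕtoℚ n * c) (*-identityˡ c) ⟨
  1ℚ * c + ℕtoℚ n * c ≡⟨ *-distribʳ-+ c 1ℚ (ℕtoℚ n) ⟨
  (1ℚ + ℕtoℚ n) * c   ≡⟨ cong (_* c) (ℕtoℚ-suc n) ⟨
  ℕtoℚ (suc n) * c    ∎
  where open ≡-Reasoning

∑-𝟙-tabulate : ∀ {A : Set} {P : Pred A 0ℓ} (P? : Decidable P) {n} (f : Fin n → A) →
               ∑[ i < n ] 𝟙 (P? (f i)) ≡ ℕtoℚ (count P? (tabulate f))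
∑-𝟙-tabulate P? {zero}  f = refl
∑-𝟙-tabulate P? {suc n} f with P? (f zero)
... | yes _ =
  trans (cong (1ℚ +_) (∑-𝟙-tabulate P? (f ∘′ suc))) (sym (ℕtoℚ-suc (count P? (tabulate (f ∘′ suc)))))
... | no _  = trans (+-identityˡ _) (∑-𝟙-tabulate P? (f ∘′ suc))

∑-𝟙-∈ : ∀ {n} (R : Subset n) → ∑[ i < n ] 𝟙 (i ∈? R) ≡ ℕtoℚ ∣ R ∣
∑-𝟙-∈ []            = refl
∑-𝟙-∈ (inside ∷ R)  = trans (cong (1ℚ +_) (∑-𝟙-∈ R)) (sym (ℕtoℚ-suc ∣ R ∣))
∑-𝟙-∈ (outside ∷ R) = trans (+-identityˡ _) (∑-𝟙-∈ R)

module _ {n : ℕ} where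

  budget-fetch-self : ∀ z (s : State n) → budget (fetch z s) z ≡ 0ℚ
  budget-fetch-self z s with z ≟ z
  ... | yes _   = refl
  ... | no z≢z = contradiction refl z≢z

  budget-fetch-other : ∀ {y z} (s : State n) → y ≢ z → budget (fetch z s) y ≡ budget s y
  budget-fetch-other {y} {z} s y≢z with y ≟ z
  ... | yes y≡z = contradiction y≡z y≢z
  ... | no _    = refl

  budget-charge-∈ : ∀ {x y} ℓ {R} (s : State n) → y ∈ₛ R → y ≢ x →
                    budget (charge x ℓ R s) y ≡ budget s y + share ℓ ∣ R ∣
  budget-charge-∈ {x} {y} ℓ {R} s y∈R y≢x with y ∈? R | y ≟ x
  ... | yes _   | no _    = refl
  ... | _       | yes y≡x = contradiction y≡x y≢x
  ... | no y∉R  | _       = contradiction y∈R y∉R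

  budget-charge-∉ : ∀ {x y} ℓ {R} (s : State n) → ¬ (y ∈ₛ R × y ≢ x) →
                    budget (charge x ℓ R s) y ≡ budget s y
  budget-charge-∉ {x} {y} ℓ {R} s ¬charged with y ∈? R | y ≟ x
  ... | yes y∈R | no y≢x = contradiction (y∈R , y≢x) ¬charged
  ... | yes _   | yes _  = refl
  ... | no _    | _      = refl

  ∣R∣>0 : ∀ {x} {R : Subset n} → x ∈ₛ R → 0 ℕ.< ∣ R ∣
  ∣R∣>0 {x} {R} x∈R = subst (ℕ._≤ ∣ R ∣) (∣⁅x⁆∣≡1 x)
    (p⊆q⇒∣p∣≤∣q∣ (λ y∈⁅x⁆ → subst (_∈ₛ R) (sym (x∈⁅y⁆⇒x≡y x y∈⁅x⁆)) x∈R))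

-- The potential

module Potential (r : ℕ) {n : ℕ} {σ : List (Fin n)} (σ↭ : σ ↭ allFin n) where

  -- The constants are dictated by κ/2 − 2η = 5 (misplaced-bound), 10κ ≤ 300r (placed-bound) and
  -- η ≥ 5|R| (5ℓ≤η*share). They, φ and Φ are opaque because unfolding them under ℕtoℚ makes the
  -- type checker normalise gcds of large terms.
  opaque
    κ η : ℕ
    κ = 20 ℕ.* r ℕ.+ 10
    η = 5 ℕ.* r

    κ>0 : 0 ℕ.< κ
    κ>0 = ℕ.≤-trans (s≤s z≤n) (ℕ.m≤n+m 10 (20 ℕ.* r))

    misplaced-bound : ∀ {q p} → 2 ℕ.* q ℕ.≤ p → 5 ℕ.* p ℕ.+ η ℕ.* (2 ℕ.* p) ℕ.≤ κ ℕ.* (p ℕ.∸ q)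
    misplaced-bound {q} {p} 2q≤p = begin
      5 ℕ.* p ℕ.+ η ℕ.* (2 ℕ.* p)            ≡⟨ lhs r p ⟩
      (10 ℕ.* r ℕ.+ 5) ℕ.* p                 ≤⟨ ℕ.*-monoʳ-≤ (10 ℕ.* r ℕ.+ 5) p≤2[p∸q] ⟩
      (10 ℕ.* r ℕ.+ 5) ℕ.* (2 ℕ.* (p ℕ.∸ q)) ≡⟨ rhs r (p ℕ.∸ q) ⟩
      κ ℕ.* (p ℕ.∸ q)                        ∎
      where
      open ℕ.≤-Reasoning
      lhs : ∀ r p → 5 ℕ.* p ℕ.+ 5 ℕ.* r ℕ.* (2 ℕ.* p) ≡ (10 ℕ.* r ℕ.+ 5) ℕ.* p
      lhs = ℕ-Solver.solve-∀
      rhs : ∀ r d → (10 ℕ.* r ℕ.+ 5) ℕ.* (2 ℕ.* d) ≡ (20 ℕ.* r ℕ.+ 10) ℕ.* d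
      rhs = ℕ-Solver.solve-∀
      p≤2[p∸q] : p ℕ.≤ 2 ℕ.* (p ℕ.∸ q)
      p≤2[p∸q] = subst (p ℕ.≤_) (sym (ℕ.*-distribˡ-∸ 2 p q))
        (ℕ.m+n≤o⇒m≤o∸n p (subst (p ℕ.+ 2 ℕ.* q ℕ.≤_) (cong (p ℕ.+_) (sym (ℕ.+-identityʳ p))) (ℕ.+-monoʳ-≤ p 2q≤p)))

    placed-bound : ∀ {ℓ q k} → 1 ℕ.≤ r → ℓ ℕ.< 2 ℕ.* (κ ℕ.* q) → q ℕ.≤ k → 5 ℕ.* ℓ ℕ.≤ 300 ℕ.* r ℕ.* k
    placed-bound {ℓ} {q} {k} 1≤r ℓ<2κq q≤k = begin
      5 ℕ.* ℓ                   ≤⟨ ℕ.*-monoʳ-≤ 5 (ℕ.<⇒≤ ℓ<2κq) ⟩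
      5 ℕ.* (2 ℕ.* (κ ℕ.* q))   ≡⟨ expand r q ⟩
      (200 ℕ.* r ℕ.+ 100) ℕ.* q ≤⟨ ℕ.*-mono-≤ 200r+100≤300r q≤k ⟩
      300 ℕ.* r ℕ.* k           ∎
      where
      open ℕ.≤-Reasoning
      expand : ∀ r q → 5 ℕ.* (2 ℕ.* ((20 ℕ.* r ℕ.+ 10) ℕ.* q)) ≡ (200 ℕ.* r ℕ.+ 100) ℕ.* q
      expand = ℕ-Solver.solve-∀
      collect : ∀ r → 200 ℕ.* r ℕ.+ 100 ℕ.* r ≡ 300 ℕ.* r
      collect = ℕ-Solver.solve-∀
      200r+100≤300r : 200 ℕ.* r ℕ.+ 100 ℕ.≤ 300 ℕ.* r
      200r+100≤300r = ℕ.≤-trans (ℕ.+-monoʳ-≤ (200 ℕ.* r) (ℕ.*-monoʳ-≤ 100 1≤r)) (ℕ.≤-reflexive (collect r))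

    5ℓ≤η*share : ∀ ℓ {s} → 0 ℕ.< s → s ℕ.≤ r → ℕtoℚ (5 ℕ.* ℓ) ≤ ℕtoℚ η * share ℓ s
    5ℓ≤η*share ℓ {s} 0<s s≤r = begin
      ℕtoℚ (5 ℕ.* ℓ)                   ≡⟨ ℕtoℚ-* 5 ℓ ⟩
      ℕtoℚ 5 * ℕtoℚ ℓ                  ≡⟨ cong (ℕtoℚ 5 *_) (share-* ℓ 0<s) ⟨
      ℕtoℚ 5 * (ℕtoℚ s * share ℓ s)    ≡⟨ *-assoc (ℕtoℚ 5) (ℕtoℚ s) (share ℓ s) ⟨
      ℕtoℚ 5 * ℕtoℚ s * share ℓ s      ≡⟨ cong (_* share ℓ s) (ℕtoℚ-* 5 s) ⟨
      ℕtoℚ (5 ℕ.* s) * share ℓ s       ≤⟨ *-monoʳ-≤-0≤ (0≤share ℓ s) (ℕtoℚ-mono-≤ (ℕ.*-monoʳ-≤ 5 s≤r)) ⟩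
      ℕtoℚ (5 ℕ.* r) * share ℓ s       ∎
      where open ≤-Reasoning

  κσ : Fin n → ℕ
  κσ y = κ ℕ.* pos σ y

  Misplaced : Fin n → ℕ → Set
  Misplaced y p = 2 ℕ.* κσ y ℕ.≤ p

  misplaced? : ∀ y p → Dec (Misplaced y p)
  misplaced? y p = 2 ℕ.* κσ y ℕ.≤? p

  opaque
    weight : Fin n → ℕ → ℚ
    weight y p = ℕtoℚ 2 - ℕtoℚ η * 𝟙 (misplaced? y p)

    φ : Fin n → ℕ → ℚ → ℚ
    φ y p β = ℕtoℚ (κ ℕ.* (p ℕ.∸ κσ y)) + weight y p * β

    weight-misplaced : ∀ {y p} → Misplaced y p → weight y p ≡ ℕtoℚ 2 - ℕtoℚ η
    weight-misplaced {y} {p} m =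
      cong (λ t → ℕtoℚ 2 - t) (trans (cong (ℕtoℚ η *_) (𝟙-yes (misplaced? y p) m)) (*-identityʳ (ℕtoℚ η)))

    weight-placed : ∀ {y p} → ¬ Misplaced y p → weight y p ≡ ℕtoℚ 2
    weight-placed {y} {p} ¬m =
      trans (cong (λ t → ℕtoℚ 2 - t) (trans (cong (ℕtoℚ η *_) (𝟙-no (misplaced? y p) ¬m)) (*-zeroʳ (ℕtoℚ η))))
            (+-identityʳ (ℕtoℚ 2))

    weight≤2 : ∀ y p → weight y p ≤ ℕtoℚ 2
    weight≤2 y p = subst (weight y p ≤_) (+-identityʳ (ℕtoℚ 2))
      (+-monoʳ-≤ (ℕtoℚ 2) (neg-antimono-≤ (0≤* (0≤ℕtoℚ η) (0≤𝟙 (misplaced? y p)))))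

    weight-antitone : ∀ y {p p′} → p ℕ.≤ p′ → weight y p′ ≤ weight y p
    weight-antitone y p≤p′ = +-monoʳ-≤ (ℕtoℚ 2) (neg-antimono-≤ (*-monoˡ-≤-0≤ (0≤ℕtoℚ η)
      (𝟙-mono (misplaced? y _) (misplaced? y _) (λ m → ℕ.≤-trans m p≤p′))))

    φ-budget-+ : ∀ y p β δ → φ y p (β + δ) ≡ φ y p β + weight y p * δ
    φ-budget-+ y p β δ = distrib (ℕtoℚ (κ ℕ.* (p ℕ.∸ κσ y))) (weight y p) β δ
      where
      distrib : ∀ a w b d → a + w * (b + d) ≡ a + w * b + w * d
      distrib = solve-∀ ℚ-ring

    φ-front : ∀ y → φ y 1 0ℚ ≡ 0ℚ
    φ-front y =
      trans (cong₂ _+_ (cong ℕtoℚ (trans (cong (κ ℕ.*_) (ℕ.m≤n⇒m∸n≡0 1≤κσ)) (ℕ.*-zeroʳ κ))) (*-zeroʳ (weight y 1)))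
            (+-identityʳ 0ℚ)
      where
      1≤κσ : 1 ℕ.≤ κσ y
      1≤κσ = ℕ.*-mono-≤ κ>0 (pos>0 σ y)

    φ-shift : ∀ y {p m β} → 0ℚ ≤ β → p ℕ.≤ m → φ y (suc p) β ≤ φ y p β + ℕtoℚ κ * 𝟙 (κσ y ℕ.≤? m)
    φ-shift y {p} {m} {β} 0≤β p≤m = begin
      ℕtoℚ (κ ℕ.* (suc p ℕ.∸ κσ y)) + weight y (suc p) * β
        ≤⟨ +-mono-≤ position-shift (*-monoʳ-≤-0≤ 0≤β (weight-antitone y (ℕ.n≤1+n p))) ⟩
      ℕtoℚ (κ ℕ.* (p ℕ.∸ κσ y)) + ℕtoℚ κ * 𝟙 (κσ y ℕ.≤? m) + weight y p * β
        ≡⟨ swap (ℕtoℚ (κ ℕ.* (p ℕ.∸ κσ y))) (ℕtoℚ κ * 𝟙 (κσ y ℕ.≤? m)) (weight y p * β) ⟩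
      ℕtoℚ (κ ℕ.* (p ℕ.∸ κσ y)) + weight y p * β + ℕtoℚ κ * 𝟙 (κσ y ℕ.≤? m) ∎
      where
      open ≤-Reasoning
      swap : ∀ x y z → x + y + z ≡ x + z + y
      swap = solve-∀ ℚ-ring
      position-shift : ℕtoℚ (κ ℕ.* (suc p ℕ.∸ κσ y)) ≤
                       ℕtoℚ (κ ℕ.* (p ℕ.∸ κσ y)) + ℕtoℚ κ * 𝟙 (κσ y ℕ.≤? m)
      position-shift with κσ y ℕ.≤? p
      ... | yes κσ≤p = ≤-reflexive (begin-equality
        ℕtoℚ (κ ℕ.* (suc p ℕ.∸ κσ y))
          ≡⟨ cong (λ d → ℕtoℚ (κ ℕ.* d)) (ℕ.+-∸-assoc 1 κσ≤p) ⟩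
        ℕtoℚ (κ ℕ.* suc (p ℕ.∸ κσ y))
          ≡⟨ cong ℕtoℚ (trans (ℕ.*-suc κ _) (ℕ.+-comm κ _)) ⟩
        ℕtoℚ (κ ℕ.* (p ℕ.∸ κσ y) ℕ.+ κ)
          ≡⟨ ℕtoℚ-+ (κ ℕ.* (p ℕ.∸ κσ y)) κ ⟩
        ℕtoℚ (κ ℕ.* (p ℕ.∸ κσ y)) + ℕtoℚ κ
          ≡⟨ cong (ℕtoℚ (κ ℕ.* (p ℕ.∸ κσ y)) +_) (*-identityʳ (ℕtoℚ κ)) ⟨
        ℕtoℚ (κ ℕ.* (p ℕ.∸ κσ y)) + ℕtoℚ κ * 1ℚ   ≡⟨ cong (λ t → ℕtoℚ (κ ℕ.* (p ℕ.∸ κσ y)) + ℕtoℚ κ * t)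
                                                      (𝟙-yes (κσ y ℕ.≤? m) (ℕ.≤-trans κσ≤p p≤m)) ⟨
        ℕtoℚ (κ ℕ.* (p ℕ.∸ κσ y)) + ℕtoℚ κ * 𝟙 (κσ y ℕ.≤? m) ∎)
      ... | no κσ≰p = begin
        ℕtoℚ (κ ℕ.* (suc p ℕ.∸ κσ y))
          ≡⟨ cong ℕtoℚ (trans (cong (κ ℕ.*_) (ℕ.m≤n⇒m∸n≡0 (ℕ.≰⇒> κσ≰p))) (ℕ.*-zeroʳ κ)) ⟩
        0ℚ
          ≤⟨ +-mono-≤ (0≤ℕtoℚ (κ ℕ.* (p ℕ.∸ κσ y))) (0≤* (0≤ℕtoℚ κ) (0≤𝟙 (κσ y ℕ.≤? m))) ⟩
        ℕtoℚ (κ ℕ.* (p ℕ.∸ κσ y)) + ℕtoℚ κ * 𝟙 (κσ y ℕ.≤? m) ∎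

    φ-misplaced : ∀ {y p β} → 0ℚ ≤ β → β ≤ ℕtoℚ (2 ℕ.* p) → Misplaced y p → ℕtoℚ (5 ℕ.* p) ≤ φ y p β
    φ-misplaced {y} {p} {β} 0≤β β≤2p m = begin
      ℕtoℚ (5 ℕ.* p)
        ≤⟨ p≤p+q (0≤* (0≤ℕtoℚ 2) 0≤β) ⟩
      ℕtoℚ (5 ℕ.* p) + ℕtoℚ 2 * β
        ≡⟨ regroup (ℕtoℚ (5 ℕ.* p)) (ℕtoℚ 2) (ℕtoℚ η) β ⟩
      ℕtoℚ (5 ℕ.* p) + ℕtoℚ η * β + (ℕtoℚ 2 - ℕtoℚ η) * β
        ≤⟨ +-monoˡ-≤ ((ℕtoℚ 2 - ℕtoℚ η) * β) (+-monoʳ-≤ (ℕtoℚ (5 ℕ.* p)) (*-monoˡ-≤-0≤ (0≤ℕtoℚ η) β≤2p)) ⟩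
      ℕtoℚ (5 ℕ.* p) + ℕtoℚ η * ℕtoℚ (2 ℕ.* p) + (ℕtoℚ 2 - ℕtoℚ η) * β
        ≡⟨ cong (_+ (ℕtoℚ 2 - ℕtoℚ η) * β) embed ⟨
      ℕtoℚ (5 ℕ.* p ℕ.+ η ℕ.* (2 ℕ.* p)) + (ℕtoℚ 2 - ℕtoℚ η) * β
        ≤⟨ +-monoˡ-≤ ((ℕtoℚ 2 - ℕtoℚ η) * β) (ℕtoℚ-mono-≤ (misplaced-bound {κσ y} {p} m)) ⟩
      ℕtoℚ (κ ℕ.* (p ℕ.∸ κσ y)) + (ℕtoℚ 2 - ℕtoℚ η) * β
        ≡⟨ cong (λ w → ℕtoℚ (κ ℕ.* (p ℕ.∸ κσ y)) + w * β) (weight-misplaced {y} {p} m) ⟨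
      φ y p β ∎
      where
      open ≤-Reasoning
      regroup : ∀ a c e b → a + c * b ≡ a + e * b + (c - e) * b
      regroup = solve-∀ ℚ-ring
      embed : ℕtoℚ (5 ℕ.* p ℕ.+ η ℕ.* (2 ℕ.* p)) ≡ ℕtoℚ (5 ℕ.* p) + ℕtoℚ η * ℕtoℚ (2 ℕ.* p)
      embed = trans (ℕtoℚ-+ (5 ℕ.* p) (η ℕ.* (2 ℕ.* p))) (cong (ℕtoℚ (5 ℕ.* p) +_) (ℕtoℚ-* η (2 ℕ.* p)))

    φ-placed : ∀ {y p β} → ¬ Misplaced y p → ℕtoℚ 2 * β ≤ φ y p β
    φ-placed {y} {p} {β} ¬m =
      subst (λ w → ℕtoℚ 2 * β ≤ ℕtoℚ (κ ℕ.* (p ℕ.∸ κσ y)) + w * β) (sym (weight-placed {y} {p} ¬m))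
            (p≤q+p (0≤ℕtoℚ (κ ℕ.* (p ℕ.∸ κσ y))))

    φ-≥ : ∀ {y p β t} → 0ℚ ≤ β → β ≤ ℕtoℚ (2 ℕ.* p) →
          t ≤ ℕtoℚ (5 ℕ.* p) → t ≤ ℕtoℚ 2 * β → t ≤ φ y p β
    φ-≥ {y} {p} {β} 0≤β β≤2p t≤5p t≤2β with misplaced? y p
    ... | yes m  = ≤-trans t≤5p (φ-misplaced {y} {p} {β} 0≤β β≤2p m)
    ... | no ¬m = ≤-trans t≤2β (φ-placed {y} {p} {β} ¬m)

    φ-≥-2[p∸1] : ∀ {y p β} → ℕtoℚ p ≤ β → β ≤ ℕtoℚ (2 ℕ.* p) → ℕtoℚ (p ℕ.∸ 1) + ℕtoℚ (p ℕ.∸ 1) ≤ φ y p β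
    φ-≥-2[p∸1] {y} {p} {β} p≤β β≤2p =
      φ-≥ {y} {p} {β} {ℕtoℚ (p ℕ.∸ 1) + ℕtoℚ (p ℕ.∸ 1)} 0≤β β≤2p
          (≤-trans 2M≤2p (ℕtoℚ-mono-≤ (ℕ.*-monoˡ-≤ p {2} {5} (s≤s (s≤s z≤n))))) (≤-trans 2M≤2p 2p≤2β)
      where
      0≤β : 0ℚ ≤ β
      0≤β = ≤-trans (0≤ℕtoℚ p) p≤β
      p∸1≤p : p ℕ.∸ 1 ℕ.≤ p
      p∸1≤p = ℕ.m∸n≤m p 1
      2M≤2p : ℕtoℚ (p ℕ.∸ 1) + ℕtoℚ (p ℕ.∸ 1) ≤ ℕtoℚ (2 ℕ.* p)
      2M≤2p = subst (_≤ ℕtoℚ (2 ℕ.* p)) (ℕtoℚ-+ (p ℕ.∸ 1) (p ℕ.∸ 1))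
                (ℕtoℚ-mono-≤ (ℕ.+-mono-≤ p∸1≤p (ℕ.≤-trans p∸1≤p (ℕ.m≤m+n p 0))))
      2p≤2β : ℕtoℚ (2 ℕ.* p) ≤ ℕtoℚ 2 * β
      2p≤2β = subst (_≤ ℕtoℚ 2 * β) (sym (ℕtoℚ-* 2 p)) (*-monoˡ-≤-0≤ (0≤ℕtoℚ 2) p≤β)

    φ+η*k≥0 : ∀ {y p β k} → 0ℚ ≤ β → β ≤ ℕtoℚ k → 0ℚ ≤ φ y p β + ℕtoℚ (η ℕ.* k)
    φ+η*k≥0 {y} {p} {β} {k} 0≤β β≤k with misplaced? y p
    ... | no ¬m =
      ≤-trans (≤-trans (0≤* (0≤ℕtoℚ 2) 0≤β) (φ-placed {y} {p} {β} ¬m)) (p≤p+q (0≤ℕtoℚ (η ℕ.* k)))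
    ... | yes m = begin
      0ℚ
        ≤⟨ ≤-trans (0≤ℕtoℚ (κ ℕ.* (p ℕ.∸ κσ y))) (p≤p+q {K} (0≤* (0≤ℕtoℚ 2) 0≤β)) ⟩
      K + ℕtoℚ 2 * β
        ≡⟨ regroup K (ℕtoℚ 2) (ℕtoℚ η) β ⟩
      K + (ℕtoℚ 2 - ℕtoℚ η) * β + ℕtoℚ η * β
        ≤⟨ +-monoʳ-≤ (K + (ℕtoℚ 2 - ℕtoℚ η) * β) (*-monoˡ-≤-0≤ (0≤ℕtoℚ η) β≤k) ⟩
      K + (ℕtoℚ 2 - ℕtoℚ η) * β + ℕtoℚ η * ℕtoℚ k
        ≡⟨ cong₂ (λ w t → K + w * β + t) (weight-misplaced {y} {p} m) (ℕtoℚ-* η k) ⟨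
      φ y p β + ℕtoℚ (η ℕ.* k)                                ∎
      where
      open ≤-Reasoning
      K : ℚ
      K = ℕtoℚ (κ ℕ.* (p ℕ.∸ κσ y))
      regroup : ∀ a c e b → a + c * b ≡ a + (c - e) * b + e * b
      regroup = solve-∀ ℚ-ring

    φ-initial : ∀ y p → φ y p 0ℚ ≤ ℕtoℚ (κ ℕ.* p)
    φ-initial y p = begin
      ℕtoℚ (κ ℕ.* (p ℕ.∸ κσ y)) + weight y p * 0ℚ
        ≡⟨ cong (ℕtoℚ (κ ℕ.* (p ℕ.∸ κσ y)) +_) (*-zeroʳ (weight y p)) ⟩
      ℕtoℚ (κ ℕ.* (p ℕ.∸ κσ y)) + 0ℚ
        ≡⟨ +-identityʳ (ℕtoℚ (κ ℕ.* (p ℕ.∸ κσ y))) ⟩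
      ℕtoℚ (κ ℕ.* (p ℕ.∸ κσ y))
        ≤⟨ ℕtoℚ-mono-≤ (ℕ.*-monoʳ-≤ κ (ℕ.m∸n≤m p (κσ y))) ⟩
      ℕtoℚ (κ ℕ.* p)                             ∎
      where open ≤-Reasoning

  opaque
    Φ : State n → ℚ
    Φ s = ∑[ y < n ] φ y (pos (order s) y) (budget s y)

    Φ≡∑φ : ∀ s → Φ s ≡ ∑[ y < n ] φ y (pos (order s) y) (budget s y)
    Φ≡∑φ s = refl

  Φ-fetch : ∀ z (s : State n) → order s ↭ allFin n → (∀ y → 0ℚ ≤ budget s y) →
            Φ (fetch z s) + φ z (pos (order s) z) (budget s z) ≤ Φ s + ℕtoℚ (pos (order s) z ℕ.∸ 1)
  Φ-fetch z s π↭ 0≤b = begin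
    Φ (fetch z s) + φ z (pos π z) (b z)         ≡⟨ cong (_+ φ z (pos π z) (b z)) (Φ≡∑φ (fetch z s)) ⟩
    ∑[ y < n ] φ y (pos (order (fetch z s)) y) (budget (fetch z s) y) + φ z (pos π z) (b z)
                                                ≤⟨ ∑-mono-except z moved-back fetched ⟩
    ∑[ y < n ] (φ y (pos π y) (b y) + e y)      ≡⟨ ∑-distrib-+ (λ y → φ y (pos π y) (b y)) e ⟩
    ∑[ y < n ] φ y (pos π y) (b y) + ∑[ y < n ] e y ≡⟨ cong (_+ ∑[ y < n ] e y) (Φ≡∑φ s) ⟨
    Φ s + ∑[ y < n ] e y                        ≤⟨ +-monoʳ-≤ (Φ s) ∑e≤m ⟩
    Φ s + ℕtoℚ m                                ∎
    where
    open ≤-Reasoning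
    π = order s
    b = budget s
    m = pos π z ℕ.∸ 1
    P? = λ y → κσ y ℕ.≤? m
    e : Fin n → ℚ
    e y = ℕtoℚ κ * 𝟙 (P? y)
    0≤e : ∀ y → 0ℚ ≤ e y
    0≤e y = 0≤* (0≤ℕtoℚ κ) (0≤𝟙 (P? y))
    moved-back : ∀ y → y ≢ z →
                 φ y (pos (order (fetch z s)) y) (budget (fetch z s) y) ≤ φ y (pos π y) (b y) + e y
    moved-back y y≢z rewrite budget-fetch-other s y≢z
      with pos-toFront (↭allFin⇒Unique π↭) (↭allFin⇒∈ π↭ z) y≢z
    ... | inj₁ (y<z , pos′) rewrite pos′ = φ-shift y (0≤b y) (ℕ.∸-monoˡ-≤ 1 y<z)
    ... | inj₂ (_ , pos′)   rewrite pos′ = p≤p+q {φ y (pos π y) (b y)} (0≤e y)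
    fetched : φ z (pos (order (fetch z s)) z) (budget (fetch z s) z) + φ z (pos π z) (b z) ≤
              φ z (pos π z) (b z) + e z
    fetched rewrite pos-toFront-self z π | budget-fetch-self z s | φ-front z =
      ≤-trans (≤-reflexive (+-identityˡ (φ z (pos π z) (b z)))) (p≤p+q {φ z (pos π z) (b z)} (0≤e z))
    ∑e≤m : ∑[ y < n ] e y ≤ ℕtoℚ m
    ∑e≤m = begin
      ∑[ y < n ] e y                          ≡⟨ *-distribˡ-sum (ℕtoℚ κ) (λ y → 𝟙 (P? y)) ⟨
      ℕtoℚ κ * ∑[ y < n ] 𝟙 (P? y)            ≡⟨ cong (ℕtoℚ κ *_) (∑-𝟙-tabulate P? id) ⟩
      ℕtoℚ κ * ℕtoℚ (count P? (allFin n))     ≡⟨ ℕtoℚ-* κ (count P? (allFin n)) ⟨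
      ℕtoℚ (κ ℕ.* count P? (allFin n))        ≤⟨ ℕtoℚ-mono-≤ (count-early κ σ m (allFin⁺ n) m<κ[1+σ]) ⟩
      ℕtoℚ m                                  ∎
      where
      m<κ[1+σ] : m ℕ.< κ ℕ.* suc (length σ)
      m<κ[1+σ] = ℕ.≤-trans (s≤s m≤σ) (ℕ.m≤n*m (suc (length σ)) κ {{ℕ.>-nonZero κ>0}})
        where
        m≤σ : m ℕ.≤ length σ
        m≤σ = ℕ.≤-trans (ℕ.m∸n≤m (pos π z) 1) (ℕ.≤-trans (pos≤length (↭allFin⇒∈ π↭ z))
                (ℕ.≤-reflexive (trans (↭allFin⇒length π↭) (sym (↭allFin⇒length σ↭)))))

  module _ (x : Fin n) (ℓ : ℕ) (R : Subset n) (s : State n) where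

    private
      π = order s
      b = budget s
      δ = share ℓ ∣ R ∣
      c = ℕtoℚ 2 * δ

    ∑-charge : x ∈ₛ R → ∑[ y < n ] (c * 𝟙 (y ∈? R)) ≡ ℕtoℚ (2 ℕ.* ℓ)
    ∑-charge x∈R = begin
      ∑[ y < n ] (c * 𝟙 (y ∈? R))
        ≡⟨ *-distribˡ-sum c (λ y → 𝟙 (y ∈? R)) ⟨
      c * ∑[ y < n ] 𝟙 (y ∈? R)
        ≡⟨ cong (c *_) (∑-𝟙-∈ R) ⟩
      ℕtoℚ 2 * δ * ℕtoℚ ∣ R ∣
        ≡⟨ *-assoc (ℕtoℚ 2) δ (ℕtoℚ ∣ R ∣) ⟩
      ℕtoℚ 2 * (δ * ℕtoℚ ∣ R ∣)
        ≡⟨ cong (ℕtoℚ 2 *_) (trans (*-comm δ (ℕtoℚ ∣ R ∣)) (share-* ℓ (∣R∣>0 x∈R))) ⟩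
      ℕtoℚ 2 * ℕtoℚ ℓ
        ≡⟨ ℕtoℚ-* 2 ℓ ⟨
      ℕtoℚ (2 ℕ.* ℓ)                ∎
      where open ≡-Reasoning

    φ-charge : ∀ y → φ y (pos π y) (budget (charge x ℓ R s) y) ≤ φ y (pos π y) (b y) + c * 𝟙 (y ∈? R)
    φ-charge y = by-cases (y ∈? R) (y ≟ x)
      where
      goal = φ y (pos π y) (budget (charge x ℓ R s) y) ≤ φ y (pos π y) (b y) + c * 𝟙 (y ∈? R)
      uncharged : ¬ (y ∈ₛ R × y ≢ x) → goal
      uncharged ¬charged =
        subst (λ β → φ y (pos π y) β ≤ φ y (pos π y) (b y) + c * 𝟙 (y ∈? R)) (sym (budget-charge-∉ ℓ s ¬charged))
              (p≤p+q {φ y (pos π y) (b y)} (0≤* (0≤* (0≤ℕtoℚ 2) (0≤share ℓ ∣ R ∣)) (0≤𝟙 (y ∈? R))))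
      by-cases : Dec (y ∈ₛ R) → Dec (y ≡ x) → goal
      by-cases (yes y∈R) (no y≢x) = begin
        φ y (pos π y) (budget (charge x ℓ R s) y)
          ≡⟨ cong (φ y (pos π y)) (budget-charge-∈ ℓ s y∈R y≢x) ⟩
        φ y (pos π y) (b y + δ)
          ≡⟨ φ-budget-+ y (pos π y) (b y) δ ⟩
        φ y (pos π y) (b y) + weight y (pos π y) * δ ≤⟨ +-monoʳ-≤ (φ y (pos π y) (b y))
                                                          (*-monoʳ-≤-0≤ (0≤share ℓ ∣ R ∣) (weight≤2 y (pos π y))) ⟩
        φ y (pos π y) (b y) + c
          ≡⟨ cong (φ y (pos π y) (b y) +_) (*-identityʳ c) ⟨
        φ y (pos π y) (b y) + c * 1ℚ
          ≡⟨ cong (λ t → φ y (pos π y) (b y) + c * t) (𝟙-yes (y ∈? R) y∈R) ⟨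
        φ y (pos π y) (b y) + c * 𝟙 (y ∈? R)         ∎
        where open ≤-Reasoning
      by-cases (yes _)   (yes y≡x) = uncharged λ (_ , y≢x) → y≢x y≡x
      by-cases (no y∉R)  _         = uncharged λ (y∈R , _) → y∉R y∈R

    private
      Φ-charge-bound : x ∈ₛ R →
                       ∑[ y < n ] (φ y (pos π y) (b y) + c * 𝟙 (y ∈? R)) ≡ Φ s + ℕtoℚ (2 ℕ.* ℓ)
      Φ-charge-bound x∈R = trans (∑-distrib-+ (λ y → φ y (pos π y) (b y)) (λ y → c * 𝟙 (y ∈? R)))
                                 (cong₂ _+_ (sym (Φ≡∑φ s)) (∑-charge x∈R))

    Φ-charge : x ∈ₛ R → Φ (charge x ℓ R s) ≤ Φ s + ℕtoℚ (2 ℕ.* ℓ)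
    Φ-charge x∈R = ≤-trans (≤-reflexive (Φ≡∑φ (charge x ℓ R s)))
                           (≤-trans (∑-mono φ-charge) (≤-reflexive (Φ-charge-bound x∈R)))

    Φ-charge-misplaced : x ∈ₛ R → ∀ {f} → f ∈ₛ R → f ≢ x → Misplaced f (pos π f) →
                         Φ (charge x ℓ R s) + ℕtoℚ η * δ ≤ Φ s + ℕtoℚ (2 ℕ.* ℓ)
    Φ-charge-misplaced x∈R {f} f∈R f≢x m =
      ≤-trans (≤-reflexive (cong (_+ ℕtoℚ η * δ) (Φ≡∑φ (charge x ℓ R s))))
        (≤-trans (∑-mono-except f (λ y _ → φ-charge y) (≤-reflexive at-f)) (≤-reflexive (Φ-charge-bound x∈R)))
      where
      open ≡-Reasoning
      cancel : ∀ a d e t → a + (d - e) * t + e * t ≡ a + d * t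
      cancel = solve-∀ ℚ-ring
      at-f : φ f (pos π f) (budget (charge x ℓ R s) f) + ℕtoℚ η * δ ≡
             φ f (pos π f) (b f) + c * 𝟙 (f ∈? R)
      at-f = begin
        φ f (pos π f) (budget (charge x ℓ R s) f) + ℕtoℚ η * δ
          ≡⟨ cong (λ β → φ f (pos π f) β + ℕtoℚ η * δ) (budget-charge-∈ ℓ s f∈R f≢x) ⟩
        φ f (pos π f) (b f + δ) + ℕtoℚ η * δ
          ≡⟨ cong (_+ ℕtoℚ η * δ) (φ-budget-+ f (pos π f) (b f) δ) ⟩
        φ f (pos π f) (b f) + weight f (pos π f) * δ + ℕtoℚ η * δ
          ≡⟨ cong (λ w → φ f (pos π f) (b f) + w * δ + ℕtoℚ η * δ) (weight-misplaced {f} {pos π f} m) ⟩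
        φ f (pos π f) (b f) + (ℕtoℚ 2 - ℕtoℚ η) * δ + ℕtoℚ η * δ
          ≡⟨ cancel (φ f (pos π f) (b f)) (ℕtoℚ 2) (ℕtoℚ η) δ ⟩
        φ f (pos π f) (b f) + c
          ≡⟨ cong (φ f (pos π f) (b f) +_) (*-identityʳ c) ⟨
        φ f (pos π f) (b f) + c * 1ℚ
          ≡⟨ cong (λ t → φ f (pos π f) (b f) + c * t) (𝟙-yes (f ∈? R) f∈R) ⟨
        φ f (pos π f) (b f) + c * 𝟙 (f ∈? R)                           ∎

  -- Amortized analysis

  record Settled (s : State n) : Set where
    field
      order-↭    : order s ↭ allFin n
      budget≥0   : ∀ y → 0ℚ ≤ budget s y
      budget<pos : ∀ y → budget s y < ℕtoℚ (pos (order s) y)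

  record Charged (s : State n) : Set where
    field
      order-↭     : order s ↭ allFin n
      budget≥0    : ∀ y → 0ℚ ≤ budget s y
      budget≤2pos : ∀ y → budget s y ≤ ℕtoℚ (2 ℕ.* pos (order s) y)

  fetch-↭ : ∀ z {s : State n} → order s ↭ allFin n → order (fetch z s) ↭ allFin n
  fetch-↭ z π↭ = ↭-trans (toFront-↭ (↭allFin⇒Unique π↭) (↭allFin⇒∈ π↭ z)) π↭

  fetch-budget≥0 : ∀ z {s : State n} → (∀ y → 0ℚ ≤ budget s y) → ∀ y → 0ℚ ≤ budget (fetch z s) y
  fetch-budget≥0 z {s} 0≤b y with y ≟ z
  ... | yes _ = ≤-refl
  ... | no _  = 0≤b y

  fetch-charged : ∀ z {s} → Charged s → Charged (fetch z s)
  fetch-charged z {s} ch = record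
    { order-↭     = fetch-↭ z {s} (Charged.order-↭ ch)
    ; budget≥0    = fetch-budget≥0 z {s} (Charged.budget≥0 ch)
    ; budget≤2pos = λ y → by-cases y (y ≟ z)
    }
    where
    π = order s
    π↭ = Charged.order-↭ ch
    by-cases : ∀ y → Dec (y ≡ z) → budget (fetch z s) y ≤ ℕtoℚ (2 ℕ.* pos (order (fetch z s)) y)
    by-cases y (yes refl) =
      subst (_≤ ℕtoℚ (2 ℕ.* pos (order (fetch z s)) y)) (sym (budget-fetch-self z s))
            (0≤ℕtoℚ (2 ℕ.* pos (order (fetch z s)) y))
    by-cases y (no y≢z)   = subst (_≤ ℕtoℚ (2 ℕ.* pos (order (fetch z s)) y)) (sym (budget-fetch-other s y≢z))
      (≤-trans (Charged.budget≤2pos ch y)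
               (ℕtoℚ-mono-≤ (ℕ.*-monoʳ-≤ 2 (pos≤pos-toFront (↭allFin⇒Unique π↭) (↭allFin⇒∈ π↭ z) y≢z))))

  cleanup-amortized : ∀ {s s′} → Cleanup s s′ → Charged s →
                      ℕtoℚ (swapDist (order s) (order s′)) + Φ s′ ≤ Φ s × Settled s′
  cleanup-amortized {s} (stop b<pos) ch =
    subst (λ d → ℕtoℚ d + Φ s ≤ Φ s) (sym (swapDist-self (order s))) (≤-reflexive (+-identityˡ (Φ s))) ,
    record { order-↭ = Charged.order-↭ ch ; budget≥0 = Charged.budget≥0 ch ; budget<pos = b<pos }
  cleanup-amortized {s} {s′} (go z p≤bz cl) ch = amortized , proj₂ rest
    where
    open ≤-Reasoning
    rest = cleanup-amortized cl (fetch-charged z ch)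
    ih = proj₁ rest
    π = order s
    π′ = order s′
    s₁ = fetch z s
    M = ℕtoℚ (pos π z ℕ.∸ 1)
    φz = φ z (pos π z) (budget s z)
    2M≤φz : M + M ≤ φz
    2M≤φz = φ-≥-2[p∸1] {z} {pos π z} {budget s z} p≤bz (Charged.budget≤2pos ch z)
    amortized : ℕtoℚ (swapDist π π′) + Φ s′ ≤ Φ s
    amortized = +-cancelʳ-≤ φz (begin
      ℕtoℚ (swapDist π π′) + Φ s′ + φz
        ≤⟨ +-monoˡ-≤ φz (+-monoˡ-≤ (Φ s′) (ℕtoℚ-mono-≤ (swapDist-via-toFront z π′ (Charged.order-↭ ch)))) ⟩
      ℕtoℚ ((pos π z ℕ.∸ 1) ℕ.+ swapDist (order s₁) π′) + Φ s′ + φz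
        ≡⟨ cong (λ t → t + Φ s′ + φz) (ℕtoℚ-+ (pos π z ℕ.∸ 1) (swapDist (order s₁) π′)) ⟩
      M + ℕtoℚ (swapDist (order s₁) π′) + Φ s′ + φz
        ≡⟨ regroup M (ℕtoℚ (swapDist (order s₁) π′)) (Φ s′) φz ⟩
      M + (ℕtoℚ (swapDist (order s₁) π′) + Φ s′) + φz
        ≤⟨ +-monoˡ-≤ φz (+-monoʳ-≤ M ih) ⟩
      M + Φ s₁ + φz
        ≡⟨ +-assoc M (Φ s₁) φz ⟩
      M + (Φ s₁ + φz)
        ≤⟨ +-monoʳ-≤ M (Φ-fetch z s (Charged.order-↭ ch) (Charged.budget≥0 ch)) ⟩
      M + (Φ s + M)
        ≡⟨ regroup′ M (Φ s) ⟩
      Φ s + (M + M)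
        ≤⟨ +-monoʳ-≤ (Φ s) 2M≤φz ⟩
      Φ s + φz                                          ∎)
      where
      regroup : ∀ a b c d → a + b + c + d ≡ a + (b + c) + d
      regroup = solve-∀ ℚ-ring
      regroup′ : ∀ a b → a + (b + a) ≡ b + (a + a)
      regroup′ = solve-∀ ℚ-ring

  settled⇒charged : ∀ {s} → Settled s → Charged s
  settled⇒charged {s} st = record
    { order-↭     = Settled.order-↭ st
    ; budget≥0    = Settled.budget≥0 st
    ; budget≤2pos = λ y →
        ≤-trans (<⇒≤ (Settled.budget<pos st y)) (ℕtoℚ-mono-≤ (ℕ.m≤n*m (pos (order s) y) 2))
    }

  module _ {R : Subset n} {s : State n} {x : Fin n} (st : Settled s)
           (x-first : ∀ y → y ∈ₛ R → pos (order s) x ℕ.≤ pos (order s) y) where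

    private
      π = order s
      π↭ = Settled.order-↭ st
      ℓ = pos π x
      s₁ = fetch x s
      s₂ = charge x ℓ R s₁
      φx = φ x ℓ (budget s x)
      K = ℕtoℚ (300 ℕ.* r ℕ.* accessCost σ R)

    request-charged : Charged s₂
    request-charged = record
      { order-↭     = Charged.order-↭ fetched
      ; budget≥0    = λ y → by-cases y (y ∈? R) (y ≟ x) (λ β → 0ℚ ≤ β)
                              (λ _ y≢x → +-mono-≤ (Charged.budget≥0 fetched y) (0≤share ℓ ∣ R ∣))
                              (λ _ → Charged.budget≥0 fetched y)
      ; budget≤2pos = λ y → by-cases y (y ∈? R) (y ≟ x) (λ β → β ≤ ℕtoℚ (2 ℕ.* pos (order s₁) y))
                              (charged-bound y) (λ _ → Charged.budget≤2pos fetched y)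
      }
      where
      fetched : Charged s₁
      fetched = fetch-charged x (settled⇒charged st)
      by-cases : ∀ y → Dec (y ∈ₛ R) → Dec (y ≡ x) → (P : ℚ → Set) →
                 (y ∈ₛ R → y ≢ x → P (budget s₁ y + share ℓ ∣ R ∣)) → (¬ (y ∈ₛ R × y ≢ x) → P (budget s₁ y)) →
                 P (budget (charge x ℓ R s₁) y)
      by-cases y (yes y∈R) (no y≢x) P charged _ = subst P (sym (budget-charge-∈ ℓ s₁ y∈R y≢x)) (charged y∈R y≢x)
      by-cases y (yes _) (yes y≡x) P _ uncharged =
        subst P (sym (budget-charge-∉ ℓ s₁ ¬charged)) (uncharged ¬charged)
        where ¬charged = λ ((_ , y≢x) : y ∈ₛ R × y ≢ x) → y≢x y≡x
      by-cases y (no y∉R) _ P _ uncharged =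
        subst P (sym (budget-charge-∉ ℓ s₁ ¬charged)) (uncharged ¬charged)
        where ¬charged = λ ((y∈R , _) : y ∈ₛ R × y ≢ x) → y∉R y∈R
      charged-bound : ∀ y → y ∈ₛ R → y ≢ x →
                      budget s₁ y + share ℓ ∣ R ∣ ≤ ℕtoℚ (2 ℕ.* pos (order s₁) y)
      charged-bound y y∈R y≢x = begin
        budget s₁ y + share ℓ ∣ R ∣
          ≡⟨ cong (_+ share ℓ ∣ R ∣) (budget-fetch-other s y≢x) ⟩
        budget s y + share ℓ ∣ R ∣
          ≤⟨ +-mono-≤ (<⇒≤ (Settled.budget<pos st y)) share≤ℓ ⟩
        ℕtoℚ (pos π y) + ℕtoℚ ℓ
          ≡⟨ ℕtoℚ-+ (pos π y) ℓ ⟨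
        ℕtoℚ (pos π y ℕ.+ ℓ)
          ≤⟨ ℕtoℚ-mono-≤ (ℕ.+-monoʳ-≤ (pos π y) (x-first y y∈R)) ⟩
        ℕtoℚ (pos π y ℕ.+ pos π y)
          ≡⟨ cong (λ t → ℕtoℚ (pos π y ℕ.+ t)) (ℕ.+-identityʳ (pos π y)) ⟨
        ℕtoℚ (2 ℕ.* pos π y)
          ≤⟨ ℕtoℚ-mono-≤ (ℕ.*-monoʳ-≤ 2 (pos≤pos-toFront (↭allFin⇒Unique π↭) (↭allFin⇒∈ π↭ x) y≢x)) ⟩
        ℕtoℚ (2 ℕ.* pos (order s₁) y) ∎
        where
        open ≤-Reasoning
        share≤ℓ : share ℓ ∣ R ∣ ≤ ℕtoℚ ℓ
        share≤ℓ = begin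
          share ℓ ∣ R ∣                    ≡⟨ *-identityˡ (share ℓ ∣ R ∣) ⟨
          1ℚ * share ℓ ∣ R ∣               ≤⟨ *-monoʳ-≤-0≤ (0≤share ℓ ∣ R ∣) (ℕtoℚ-mono-≤ (∣R∣>0 y∈R)) ⟩
          ℕtoℚ ∣ R ∣ * share ℓ ∣ R ∣       ≡⟨ share-* ℓ (∣R∣>0 y∈R) ⟩
          ℕtoℚ ℓ                           ∎

    request-cost : ∀ {s′} Φ₂ B → ℕtoℚ (swapDist (order s₁) (order s′)) + Φ s′ ≤ Φ₂ →
                   Φ₂ + B ≤ Φ s₁ + ℕtoℚ (2 ℕ.* ℓ) →
                   ℕtoℚ (ℓ ℕ.+ swapDist π (order s′)) + Φ s′ + (φx + B) ≤ Φ s + ℕtoℚ (5 ℕ.* ℓ)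
    request-cost {s′} Φ₂ B cleaned charged = begin
      ℕtoℚ (ℓ ℕ.+ swapDist π π′) + Φ s′ + (φx + B)
        ≤⟨ +-monoˡ-≤ (φx + B) (+-monoˡ-≤ (Φ s′) (ℕtoℚ-mono-≤ (ℕ.+-monoʳ-≤ ℓ (swapDist-via-toFront x π′ π↭)))) ⟩
      ℕtoℚ (ℓ ℕ.+ (L ℕ.+ sw₁)) + Φ s′ + (φx + B)
        ≡⟨ cong (λ t → t + Φ s′ + (φx + B)) (trans (cong ℕtoℚ (sym (ℕ.+-assoc ℓ L sw₁))) (ℕtoℚ-+ (ℓ ℕ.+ L) sw₁)) ⟩
      ℕtoℚ (ℓ ℕ.+ L) + ℕtoℚ sw₁ + Φ s′ + (φx + B)
        ≤⟨ telescope (ℕtoℚ (ℓ ℕ.+ L)) (ℕtoℚ sw₁) (Φ s′) Φ₂ B (Φ s₁) (ℕtoℚ (2 ℕ.* ℓ)) φx (Φ s) (ℕtoℚ L)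
                     cleaned charged (Φ-fetch x s π↭ (Settled.budget≥0 st)) ⟩
      Φ s + (ℕtoℚ (ℓ ℕ.+ L) + ℕtoℚ (2 ℕ.* ℓ) + ℕtoℚ L)
        ≡⟨ cong (Φ s +_) (trans (ℕtoℚ-+ (ℓ ℕ.+ L ℕ.+ 2 ℕ.* ℓ) L) (cong (_+ ℕtoℚ L) (ℕtoℚ-+ (ℓ ℕ.+ L) (2 ℕ.* ℓ)))) ⟨
      Φ s + ℕtoℚ (ℓ ℕ.+ L ℕ.+ 2 ℕ.* ℓ ℕ.+ L)
        ≤⟨ +-monoʳ-≤ (Φ s) (ℕtoℚ-mono-≤ ℓ+L+2ℓ+L≤5ℓ) ⟩
      Φ s + ℕtoℚ (5 ℕ.* ℓ) ∎
      where
      open ≤-Reasoning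
      π′ = order s′
      L = ℓ ℕ.∸ 1
      sw₁ = swapDist (order s₁) π′
      five : ∀ ℓ → ℓ ℕ.+ ℓ ℕ.+ 2 ℕ.* ℓ ℕ.+ ℓ ≡ 5 ℕ.* ℓ
      five = ℕ-Solver.solve-∀
      L≤ℓ = ℕ.m∸n≤m ℓ 1
      ℓ+L+2ℓ+L≤5ℓ : ℓ ℕ.+ L ℕ.+ 2 ℕ.* ℓ ℕ.+ L ℕ.≤ 5 ℕ.* ℓ
      ℓ+L+2ℓ+L≤5ℓ = ℕ.≤-trans (ℕ.+-mono-≤ (ℕ.+-monoˡ-≤ (2 ℕ.* ℓ) (ℕ.+-monoʳ-≤ ℓ L≤ℓ)) L≤ℓ) (ℕ.≤-reflexive (five ℓ))

    request-bonus : x ∈ₛ R → ∣ R ∣ ℕ.≤ r →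
                    ∃[ B ] (Φ s₂ + B ≤ Φ s₁ + ℕtoℚ (2 ℕ.* ℓ)) × (ℕtoℚ (5 ℕ.* ℓ) ≤ K + (φx + B))
    request-bonus x∈R ∣R∣≤r = by-cases (ℓ ℕ.<? 2 ℕ.* κσ f) (x ≟ f)
      where
      0≤K = 0≤ℕtoℚ (300 ℕ.* r ℕ.* accessCost σ R)
      0≤bx = Settled.budget≥0 st x
      bx≤2ℓ = Charged.budget≤2pos (settled⇒charged st) x
      0≤φx : 0ℚ ≤ φx
      0≤φx = φ-≥ {x} {ℓ} {budget s x} {0ℚ} 0≤bx bx≤2ℓ (0≤ℕtoℚ (5 ℕ.* ℓ)) (0≤* (0≤ℕtoℚ 2) 0≤bx)
      first-in-σ = accessCost-witness x∈R (↭allFin⇒∈ σ↭ x)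
      f = proj₁ first-in-σ
      f∈R = proj₁ (proj₂ first-in-σ)
      no-bonus : Φ s₂ + 0ℚ ≤ Φ s₁ + ℕtoℚ (2 ℕ.* ℓ)
      no-bonus = subst (_≤ Φ s₁ + ℕtoℚ (2 ℕ.* ℓ)) (sym (+-identityʳ (Φ s₂))) (Φ-charge x ℓ R s₁ x∈R)
      by-cases : Dec (ℓ ℕ.< 2 ℕ.* κσ f) → Dec (x ≡ f) →
                 ∃[ B ] (Φ s₂ + B ≤ Φ s₁ + ℕtoℚ (2 ℕ.* ℓ)) × (ℕtoℚ (5 ℕ.* ℓ) ≤ K + (φx + B))
      by-cases (yes ℓ<2κσf) _ =
        0ℚ , no-bonus , ≤-trans 5ℓ≤K (p≤p+q {K} (≤-trans 0≤φx (≤-reflexive (sym (+-identityʳ φx)))))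
        where
        5ℓ≤K : ℕtoℚ (5 ℕ.* ℓ) ≤ K
        5ℓ≤K = ℕtoℚ-mono-≤ (placed-bound (ℕ.≤-trans (∣R∣>0 x∈R) ∣R∣≤r) ℓ<2κσf (proj₂ (proj₂ first-in-σ)))
      by-cases (no ℓ≮2κσf) (yes x≡f) =
        0ℚ , no-bonus ,
        ≤-trans (φ-misplaced {x} {ℓ} {budget s x} 0≤bx bx≤2ℓ x-misplaced)
                (≤-trans (≤-reflexive (sym (+-identityʳ φx))) (p≤q+p {φx + 0ℚ} {K} 0≤K))
        where
        x-misplaced : Misplaced x ℓ
        x-misplaced = subst (λ w → Misplaced w ℓ) (sym x≡f) (ℕ.≮⇒≥ ℓ≮2κσf)
      by-cases (no ℓ≮2κσf) (no x≢f) =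
        ℕtoℚ η * δ , Φ-charge-misplaced x ℓ R s₁ x∈R f∈R (≢-sym x≢f) f-misplaced ,
        ≤-trans (5ℓ≤η*share ℓ (∣R∣>0 x∈R) ∣R∣≤r)
                (≤-trans (p≤q+p {ℕtoℚ η * δ} {φx} 0≤φx) (p≤q+p {φx + ℕtoℚ η * δ} {K} 0≤K))
        where
        δ = share ℓ ∣ R ∣
        f-misplaced : Misplaced f (pos (order s₁) f)
        f-misplaced = ℕ.≤-trans (ℕ.≮⇒≥ ℓ≮2κσf) (ℕ.≤-trans (x-first f f∈R)
                        (pos≤pos-toFront (↭allFin⇒Unique π↭) (↭allFin⇒∈ π↭ x) (≢-sym x≢f)))

  step-amortized : ∀ {R s c s′} → Step R s c s′ → Settled s → ∣ R ∣ ℕ.≤ r →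
                   ℕtoℚ c + Φ s′ ≤ ℕtoℚ (300 ℕ.* r ℕ.* accessCost σ R) + Φ s × Settled s′
  step-amortized {R} {s} {_} {s′} (step x x∈R x-first cl) st ∣R∣≤r =
    +-cancelʳ-≤ (φx + B) (begin
      ℕtoℚ (ℓ ℕ.+ swapDist (order s) (order s′)) + Φ s′ + (φx + B)
        ≤⟨ request-cost st x-first (Φ s₂) B (proj₁ cleaned) charged ⟩
      Φ s + ℕtoℚ (5 ℕ.* ℓ)
        ≤⟨ +-monoʳ-≤ (Φ s) paid ⟩
      Φ s + (K + (φx + B))
        ≡⟨ regroup (Φ s) K (φx + B) ⟩
      K + Φ s + (φx + B)                                          ∎) , proj₂ cleaned
    where
    open ≤-Reasoning
    ℓ = pos (order s) x
    s₂ = charge x ℓ R (fetch x s)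
    φx = φ x ℓ (budget s x)
    K = ℕtoℚ (300 ℕ.* r ℕ.* accessCost σ R)
    cleaned = cleanup-amortized cl (request-charged st x-first)
    bonus = request-bonus st x-first x∈R ∣R∣≤r
    B = proj₁ bonus
    charged = proj₁ (proj₂ bonus)
    paid = proj₂ (proj₂ bonus)
    regroup : ∀ a b c → a + (b + c) ≡ b + a + c
    regroup = solve-∀ ℚ-ring

  run-amortized : ∀ {s Rs c s′} → Run s Rs c s′ → Settled s → All (λ R → Nonempty R × ∣ R ∣ ℕ.≤ r) Rs →
                  ℕtoℚ c + Φ s′ ≤ ℕtoℚ (300 ℕ.* r ℕ.* offCost σ Rs) + Φ s × Settled s′
  run-amortized {s} done st [] =
    subst (λ k → ℕtoℚ 0 + Φ s ≤ ℕtoℚ k + Φ s) (sym (ℕ.*-zeroʳ (300 ℕ.* r))) ≤-refl , st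
  run-amortized {s} {R ∷ Rs} (next {s₁ = s₁} {s₂ = s₂} {c = c} {c' = c′} st run) settled ((_ , ∣R∣≤r) ∷ valid) =
    subst₂ (λ a k → a + Φ s₂ ≤ k + Φ s) (sym (ℕtoℚ-+ c c′)) (sym cost-split)
      (amortize-trans (ℕtoℚ c) (ℕtoℚ c′) K₁ K₂ (Φ s) (Φ s₁) (Φ s₂) (proj₁ first) (proj₁ others)) ,
    proj₂ others
    where
    first = step-amortized st settled ∣R∣≤r
    others = run-amortized run (proj₂ first) valid
    K₁ = ℕtoℚ (300 ℕ.* r ℕ.* accessCost σ R)
    K₂ = ℕtoℚ (300 ℕ.* r ℕ.* offCost σ Rs)
    cost-split : ℕtoℚ (300 ℕ.* r ℕ.* offCost σ (R ∷ Rs)) ≡ K₁ + K₂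
    cost-split = trans (cong ℕtoℚ (ℕ.*-distribˡ-+ (300 ℕ.* r) (accessCost σ R) (offCost σ Rs)))
                       (ℕtoℚ-+ (300 ℕ.* r ℕ.* accessCost σ R) (300 ℕ.* r ℕ.* offCost σ Rs))

  initial-settled : ∀ {π₀} → π₀ ↭ allFin n → Settled (initial π₀)
  initial-settled {π₀} π₀↭ = record
    { order-↭    = π₀↭
    ; budget≥0   = λ _ → ≤-refl
    ; budget<pos = λ y → <-≤-trans (positive⁻¹ 1ℚ) (ℕtoℚ-mono-≤ (pos>0 π₀ y))
    }

  Φ-initial : ∀ {π₀} → π₀ ↭ allFin n → Φ (initial π₀) ≤ ℕtoℚ (n ℕ.* (κ ℕ.* n))
  Φ-initial {π₀} π₀↭ = begin
    Φ (initial π₀)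
      ≡⟨ Φ≡∑φ (initial π₀) ⟩
    ∑[ y < n ] φ y (pos π₀ y) 0ℚ
      ≤⟨ ∑-mono (λ y → ≤-trans (φ-initial y (pos π₀ y)) (ℕtoℚ-mono-≤ (ℕ.*-monoʳ-≤ κ (pos≤n y)))) ⟩
    ∑[ y < n ] ℕtoℚ (κ ℕ.* n)
      ≡⟨ ∑-const n (ℕtoℚ (κ ℕ.* n)) ⟩
    ℕtoℚ n * ℕtoℚ (κ ℕ.* n)
      ≡⟨ ℕtoℚ-* n (κ ℕ.* n) ⟨
    ℕtoℚ (n ℕ.* (κ ℕ.* n))              ∎
    where
    open ≤-Reasoning
    pos≤n : ∀ y → pos π₀ y ℕ.≤ n
    pos≤n y = ℕ.≤-trans (pos≤length (↭allFin⇒∈ π₀↭ y)) (ℕ.≤-reflexive (↭allFin⇒length π₀↭))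

  Φ-lower-bound : ∀ {s} → Settled s → 0ℚ ≤ Φ s + ℕtoℚ (n ℕ.* (η ℕ.* n))
  Φ-lower-bound {s} st = begin
    0ℚ
      ≡⟨ *-zeroʳ (ℕtoℚ n) ⟨
    ℕtoℚ n * 0ℚ
      ≡⟨ ∑-const n 0ℚ ⟨
    ∑[ y < n ] 0ℚ
      ≤⟨ ∑-mono (λ y → φ+η*k≥0 {y} {pos π y} {budget s y} {n} (Settled.budget≥0 st y) (budget≤n y)) ⟩
    ∑[ y < n ] (φ y (pos π y) (budget s y) + ℕtoℚ (η ℕ.* n))
      ≡⟨ ∑-distrib-+ (λ y → φ y (pos π y) (budget s y)) (λ _ → ℕtoℚ (η ℕ.* n)) ⟩
    ∑[ y < n ] φ y (pos π y) (budget s y) + ∑[ y < n ] ℕtoℚ (η ℕ.* n)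
      ≡⟨ cong₂ _+_ (Φ≡∑φ s) (trans (ℕtoℚ-* n (η ℕ.* n)) (sym (∑-const n (ℕtoℚ (η ℕ.* n))))) ⟨
    Φ s + ℕtoℚ (n ℕ.* (η ℕ.* n)) ∎
    where
    open ≤-Reasoning
    π = order s
    π↭ = Settled.order-↭ st
    budget≤n : ∀ y → budget s y ≤ ℕtoℚ n
    budget≤n y = ≤-trans (<⇒≤ (Settled.budget<pos st y))
                   (ℕtoℚ-mono-≤ (ℕ.≤-trans (pos≤length (↭allFin⇒∈ π↭ y)) (ℕ.≤-reflexive (↭allFin⇒length π↭))))

  competitive : ∀ {π₀ Rs c s} → π₀ ↭ allFin n → All (λ R → Nonempty R × ∣ R ∣ ℕ.≤ r) Rs →
                Run (initial π₀) Rs c s →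
                c ℕ.≤ 300 ℕ.* r ℕ.* offCost σ Rs ℕ.+ (n ℕ.* (κ ℕ.* n) ℕ.+ n ℕ.* (η ℕ.* n))
  competitive {π₀} {Rs} {c} {s} π₀↭ valid run = ℕtoℚ-cancel-≤ (begin
    ℕtoℚ c
      ≡⟨ +-identityʳ (ℕtoℚ c) ⟨
    ℕtoℚ c + 0ℚ
      ≤⟨ +-monoʳ-≤ (ℕtoℚ c) (Φ-lower-bound (proj₂ amortized)) ⟩
    ℕtoℚ c + (Φ s + L)
      ≡⟨ +-assoc (ℕtoℚ c) (Φ s) L ⟨
    ℕtoℚ c + Φ s + L
      ≤⟨ +-monoˡ-≤ L (proj₁ amortized) ⟩
    K + Φ (initial π₀) + L
      ≤⟨ +-monoˡ-≤ L (+-monoʳ-≤ K (Φ-initial π₀↭)) ⟩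
    K + U + L
      ≡⟨ +-assoc K U L ⟩
    K + (U + L)
      ≡⟨ trans (ℕtoℚ-+ (300 ℕ.* r ℕ.* offCost σ Rs) (n ℕ.* (κ ℕ.* n) ℕ.+ n ℕ.* (η ℕ.* n)))
               (cong (K +_) (ℕtoℚ-+ (n ℕ.* (κ ℕ.* n)) (n ℕ.* (η ℕ.* n)))) ⟨
    ℕtoℚ (300 ℕ.* r ℕ.* offCost σ Rs ℕ.+ (n ℕ.* (κ ℕ.* n) ℕ.+ n ℕ.* (η ℕ.* n))) ∎)
    where
    open ≤-Reasoning
    amortized = run-amortized run (initial-settled π₀↭) valid
    K = ℕtoℚ (300 ℕ.* r ℕ.* offCost σ Rs)
    U = ℕtoℚ (n ℕ.* (κ ℕ.* n))
    L = ℕtoℚ (n ℕ.* (η ℕ.* n))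

theorem10 : ∃[ C ] (0 ℕ.< C ×
    ((n r : ℕ) → 0 ℕ.< n → 0 ℕ.< r →
     (π₀ : List (Fin n)) → π₀ ↭ allFin n →
     (σ : List (Fin n)) → σ ↭ allFin n →
     ∃[ ξ ] ((Rs : List (Subset n)) →
             All (λ R → Nonempty R × ∣ R ∣ ℕ.≤ r) Rs →
             (c : ℕ) (s : State n) → Run (initial π₀) Rs c s →
             c ℕ.≤ C ℕ.* r ℕ.* offCost σ Rs ℕ.+ ξ)))
theorem10 = 300 , s≤s z≤n , λ n r _ _ π₀ π₀↭ σ σ↭ → let open Potential r σ↭ in
  n ℕ.* (κ ℕ.* n) ℕ.+ n ℕ.* (η ℕ.* n) , λ Rs valid c s run → competitive π₀↭ valid run
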